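{- Let $q=p$ be a prime, let $1\le\ell\le q-1$, and let $Y=\mathbb{F}_q[x_1,\dots,x_\ell,\theta]$, on which $S_\ell$ acts by $\sigma(x_i)=x_{\sigma(i)}$, $\sigma(\theta)=\theta$ (extended to ring automorphisms). For each multiset $\nu=\{\nu_1,\dots,\nu_\ell\}$ of nonnegative integers set \[ P(\nu)=\prod_{i=1}^\ell\prod_{j=0}^{\nu_i-1}\bigl(x_i-\theta^{q^j}\bigr),\qquad b_{q^\nu}=\frac{1}{\ell!}\sum_{\sigma\in S_\ell}\sigma(P(\nu)), \] where $q^\nu=q^{\nu_1}+\dots+q^{\nu_\ell}$. Then $b_\ell=1$ (the term for $\nu=\{0,\dots,0\}$), and for every multiset $\nu$ of $\ell$ nonnegative integers, \[ b_{q^\nu}\prod_{i=1}^\ell x_i=\sum_{I\subset\{1,\dots,\ell\}}b_{q^{\nu^+(I)}}\prod_{j\in I^c}\theta^{q^{\nu_j}}. \]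
   Context: For $I\subset\{1,\dots,\ell\}$ with complement $I^c$, $\nu^+(I)$ denotes the multiset $\{1+\nu_i:i\in I\}\cup\{\nu_j:j\in I^c\}$. The expression $P(\nu)$ is well defined after choosing an ordering of the entries of $\nu$; $b_{q^\nu}$ does not depend on that choice. -}

module Defs where

open import Data.Bool using (Bool; true; false; if_then_else_; not; _∧_; _∨_)
open import Data.Nat as ℕ using (ℕ; zero; suc)
open import Data.Integer as ℤ using (ℤ; +_)
open import Data.Integer.Divisibility as ℤD using ()
open import Data.Fin as Fin using (Fin)
open import Data.Fin.Subset using (Subset)
open import Data.Vec as V using (Vec; []; _∷_; lookup; tabulate; replicate; zipWith)
open import Data.Vec.Properties as VP using ()
open import Data.List as L using (List; []; _∷_; map; foldr; concatMap; filter; _++_)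
open import Data.Product using (_×_; _,_; proj₁; proj₂)
open import Relation.Nullary.Decidable using (⌊_⌋)

-- Polynomials in F_p[x_1..x_ℓ, θ], represented by a finite list of terms
-- (integer coefficient, monomial); coefficients are read modulo p.
-- A monomial is (exponent vector of x_1..x_ℓ , exponent of θ).
Mono : ℕ → Set
Mono ℓ = Vec ℕ ℓ × ℕ

Poly : ℕ → Set
Poly ℓ = List (ℤ × Mono ℓ)

monoEq : ∀ {ℓ} → Mono ℓ → Mono ℓ → Bool
monoEq (a , k) (b , m) = ⌊ VP.≡-dec ℕ._≟_ a b ⌋ ∧ ⌊ k ℕ.≟ m ⌋

coeff : ∀ {ℓ} → Poly ℓ → Mono ℓ → ℤ
coeff P m = foldr (λ t acc → (if monoEq (proj₂ t) m then proj₁ t else + 0) ℤ.+ acc) (+ 0) P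

_≈[_]_ : ∀ {ℓ} → Poly ℓ → ℕ → Poly ℓ → Set
P ≈[ p ] Q = ∀ m → (+ p) ℤD.∣ (coeff P m ℤ.- coeff Q m)

infix 4 _≈[_]_

0P : ∀ {ℓ} → Poly ℓ
0P = []

1P : ∀ {ℓ} → Poly ℓ
1P {ℓ} = (+ 1 , replicate ℓ 0 , 0) ∷ []

_+P_ : ∀ {ℓ} → Poly ℓ → Poly ℓ → Poly ℓ
P +P Q = P ++ Q

-P_ : ∀ {ℓ} → Poly ℓ → Poly ℓ
-P P = map (λ t → ℤ.- proj₁ t , proj₂ t) P

_-P_ : ∀ {ℓ} → Poly ℓ → Poly ℓ → Poly ℓ
P -P Q = P +P (-P Q)

_*P_ : ∀ {ℓ} → Poly ℓ → Poly ℓ → Poly ℓ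
P *P Q = concatMap (λ s → map (λ t → proj₁ s ℤ.* proj₁ t ,
           zipWith ℕ._+_ (proj₁ (proj₂ s)) (proj₁ (proj₂ t)) ,
           proj₂ (proj₂ s) ℕ.+ proj₂ (proj₂ t)) Q) P

scale : ∀ {ℓ} → ℤ → Poly ℓ → Poly ℓ
scale c P = map (λ t → c ℤ.* proj₁ t , proj₂ t) P

sumP : ∀ {ℓ} → List (Poly ℓ) → Poly ℓ
sumP = foldr _+P_ 0P

prodP : ∀ {ℓ} → List (Poly ℓ) → Poly ℓ
prodP = foldr _*P_ 1P

X : ∀ {ℓ} → Fin ℓ → Poly ℓ
X i = (+ 1 , tabulate (λ j → if ⌊ i Fin.≟ j ⌋ then 1 else 0) , 0) ∷ []

θ^ : ∀ {ℓ} → ℕ → Poly ℓ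
θ^ {ℓ} k = (+ 1 , replicate ℓ 0 , k) ∷ []

-- Permutations of {1..ℓ} (= Fin ℓ) as vectors σ with σ(i) = lookup σ i;
-- S_ℓ is enumerated as all injective maps Fin ℓ → Fin ℓ.
allVecs : ∀ n m → List (Vec (Fin m) n)
allVecs zero m = [] ∷ []
allVecs (suc n) m = concatMap (λ i → map (i ∷_) (allVecs n m)) (L.allFin m)

allB : ∀ {A : Set} → (A → Bool) → List A → Bool
allB f xs = foldr (λ x acc → f x ∧ acc) true xs

injective? : ∀ {n} → Vec (Fin n) n → Bool
injective? {n} σ = allB (λ i → allB (λ j →
  ⌊ i Fin.≟ j ⌋ ∨ not ⌊ lookup σ i Fin.≟ lookup σ j ⌋) (L.allFin n)) (L.allFin n)

Sym : ∀ ℓ → List (Vec (Fin ℓ) ℓ)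
Sym ℓ = filter (λ σ → injective? σ Data.Bool.≟ true) (allVecs ℓ ℓ)
  where import Data.Bool

-- action of σ as the ring automorphism x_i ↦ x_{σ(i)}, θ ↦ θ:
-- the monomial ∏ x_i^{a_i} θ^k goes to ∏ x_{σ(i)}^{a_i} θ^k
actMono : ∀ {ℓ} → Vec (Fin ℓ) ℓ → Mono ℓ → Mono ℓ
actMono {ℓ} σ (a , k) =
  tabulate (λ j → V.sum (tabulate (λ i → if ⌊ lookup σ i Fin.≟ j ⌋ then lookup a i else 0))) , k

act : ∀ {ℓ} → Vec (Fin ℓ) ℓ → Poly ℓ → Poly ℓ
act σ P = map (λ t → proj₁ t , actMono σ (proj₂ t)) P

Pν : ∀ {ℓ} → ℕ → Vec ℕ ℓ → Poly ℓ
Pν {ℓ} p ν = prodP (map (λ i → prodP (map (λ j → X i -P θ^ (p ℕ.^ j)) (L.upTo (lookup ν i))))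
                       (L.allFin ℓ))

-- inverse of ℓ! in F_p (p prime, ℓ < p), via Fermat: (ℓ!)^(p-2)
invFact : ℕ → ℕ → ℤ
invFact p ℓ = + ((ℓ ℕ.!) ℕ.^ (p ℕ.∸ 2))

b : ∀ {ℓ} → ℕ → Vec ℕ ℓ → Poly ℓ
b {ℓ} p ν = scale (invFact p ℓ) (sumP (map (λ σ → act σ (Pν p ν)) (Sym ℓ)))

allSubsets : ∀ n → List (Subset n)
allSubsets zero = [] ∷ []
allSubsets (suc n) = map (true ∷_) (allSubsets n) ++ map (false ∷_) (allSubsets n)

_⁺_ : ∀ {ℓ} → Vec ℕ ℓ → Subset ℓ → Vec ℕ ℓ
ν ⁺ I = zipWith (λ n inI → if inI then suc n else n) ν I

θcompl : ∀ {ℓ} → ℕ → Vec ℕ ℓ → Subset ℓ → Poly ℓ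
θcompl {ℓ} p ν I = prodP (map (λ j → if lookup I j then 1P else θ^ (p ℕ.^ lookup ν j)) (L.allFin ℓ))

prodX : ∀ ℓ → Poly ℓ
prodX ℓ = prodP (map X (L.allFin ℓ))

-- The identity already holds over ℤ, and with arbitrary polynomials y_i in place of x_i.
-- Writing Q_v(y) = ∏_{j<v} (y − θ^{p^j}), one has Q_v(y)·y = Q_{v+1}(y) + Q_v(y)·θ^{p^v};
-- multiplying these ℓ identities and expanding the product of binomials gives
--   ∏_i Q_{ν_i}(y_i) · ∏_i y_i = Σ_I ∏_i Q_{ν⁺(I)_i}(y_i) · ∏_{j∉I} θ^{p^{ν_j}}.
-- Taking y_i = σ(x_i) for σ ∈ S_ℓ, which fixes ∏_i x_i, and averaging over S_ℓ gives the
-- recursion. For the first claim, every σ(P(0)) is 1 and |S_ℓ| = ℓ!, so b_ℓ = (ℓ!)^{p−2}·ℓ!,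
-- which is 1 mod p by Fermat's little theorem since p ∤ ℓ!.

module Submission where

open import Defs
open import Data.Nat using (ℕ; _≤_; _<_)
open import Data.Nat.Primality using (Prime)
open import Data.Vec using (Vec; replicate)
open import Data.List using (map)
open import Data.Product using (_×_)

open import Algebra.Bundles using (CommutativeMonoid)
open import Algebra.Structures.Biased using (isCommutativeMonoidˡ)
open import Data.Bool using (Bool; true; false; if_then_else_; _∧_; _∨_; not)
import Data.Bool.Properties as BP
open import Data.Empty using (⊥-elim)
open import Data.Fin as Fin using (Fin)
import Data.Fin.Properties as FinP
open import Data.Integer as ℤ using (ℤ; +_)
import Data.Integer.Divisibility as ℤD
import Data.Integer.Properties as ℤP
open import Data.List as L using (List; []; _∷_; _++_; foldr; concatMap)
open import Data.List.Membership.Propositional using () renaming (_∈_ to _∈ₗ_)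
open import Data.List.Membership.Propositional.Properties using (∈-filter⁻)
import Data.List.Properties as LP
open import Data.List.Relation.Unary.Any using (here; there)
open import Data.Nat as ℕ using (zero; suc)
open import Data.Nat.Combinatorics
  using (_C_; nCk≡n!/k![n-k]!; k![n∸k]!∣n!; nCk+nC[k+1]≡[n+1]C[k+1]; nCn≡1; nC1≡n; k>n⇒nCk≡0)
open import Data.Nat.Combinatorics.Base using () renaming (_P′_ to fallingFactorial)
open import Data.Nat.Combinatorics.Specification using (nP′n≡n!)
open import Data.Nat.Divisibility using (_∣_; divides; ∣⇒≤; _∣0; ∣-trans; m∣m*n)
open import Data.Nat.DivMod using (m/n*n≡m)
open import Data.Nat.Primality using (prime⇒nonTrivial; euclidsLemma)
import Data.Nat.Properties as ℕP
open import Data.Nat.Solver using (module +-*-Solver)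
open import Data.Product using (_,_; proj₁; proj₂; uncurry; ∃)
import Data.Product.Properties as ×P
open import Data.Sum using (inj₁; inj₂)
import Data.Vec as V
open import Data.Vec.Membership.Propositional using (_∈_; _∉_)
open import Data.Vec.Membership.Propositional.Properties using (∈-lookup)
import Data.Vec.Properties as VP
open import Data.Vec.Relation.Binary.Pointwise.Inductive as Pointwise using (Pointwise; []; _∷_)
import Data.Vec.Relation.Unary.Any as Any
open import Data.Vec.Relation.Unary.Any.Properties using (lookup-index)
open import Function using (id; _∘_; _⇔_; mk⇔; module Equivalence; case_of_)
open import Function.Definitions using (Injective)
open import Level using (0ℓ)
open import Relation.Binary.Bundles using (Setoid)
open import Relation.Binary.PropositionalEquality as ≡ using (_≡_)
open import Relation.Binary.Structures using (IsEquivalence)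
open import Relation.Nullary using (Dec; yes; no; does; ¬_; ¬?)
open import Relation.Nullary.Decidable using (_×-dec_; map′; does-⇔; isYes; isYes≗does; dec-false)

open import Algebra.Properties.CommutativeSemigroup ℕP.+-commutativeSemigroup
  using () renaming (interchange to +-interchange)
open +-*-Solver using (solve; _:+_; _:*_; _:=_; con)

module ListSum {c ℓ} (M : CommutativeMonoid c ℓ) where
  open CommutativeMonoid M renaming (Carrier to C)
  open import Algebra.Properties.CommutativeSemigroup commutativeSemigroup using (interchange)
  open import Relation.Binary.Reasoning.Setoid setoid

  Σ : {A : Set} → List A → (A → C) → C
  Σ xs f = foldr (λ x acc → f x ∙ acc) ε xs

  private variable
    A B : Set

  Σ-cong-∈ : ∀ (xs : List A) {f g} → (∀ {x} → x ∈ₗ xs → f x ≈ g x) → Σ xs f ≈ Σ xs g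
  Σ-cong-∈ []       f≈g = refl
  Σ-cong-∈ (x ∷ xs) f≈g = ∙-cong (f≈g (here ≡.refl)) (Σ-cong-∈ xs (f≈g ∘ there))

  Σ-cong : ∀ (xs : List A) {f g} → (∀ x → f x ≈ g x) → Σ xs f ≈ Σ xs g
  Σ-cong xs f≈g = Σ-cong-∈ xs (λ {x} _ → f≈g x)

  Σ-++ : ∀ (xs ys : List A) f → Σ (xs ++ ys) f ≈ Σ xs f ∙ Σ ys f
  Σ-++ []       ys f = sym (identityˡ _)
  Σ-++ (x ∷ xs) ys f = begin
    f x ∙ Σ (xs ++ ys) f        ≈⟨ ∙-congˡ (Σ-++ xs ys f) ⟩
    f x ∙ (Σ xs f ∙ Σ ys f)     ≈⟨ assoc _ _ _ ⟨
    (f x ∙ Σ xs f) ∙ Σ ys f     ∎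

  Σ-ε : ∀ (xs : List A) → Σ xs (λ _ → ε) ≈ ε
  Σ-ε []       = refl
  Σ-ε (x ∷ xs) = trans (identityˡ _) (Σ-ε xs)

  Σ-∙ : ∀ (xs : List A) f g → Σ xs (λ x → f x ∙ g x) ≈ Σ xs f ∙ Σ xs g
  Σ-∙ []       f g = sym (identityˡ ε)
  Σ-∙ (x ∷ xs) f g = trans (∙-congˡ (Σ-∙ xs f g)) (interchange _ _ _ _)

  Σ-map : ∀ (g : B → A) (xs : List B) f → Σ (map g xs) f ≡ Σ xs (f ∘ g)
  Σ-map g []       f = ≡.refl
  Σ-map g (x ∷ xs) f = ≡.cong (f (g x) ∙_) (Σ-map g xs f)

  Σ-concatMap : ∀ (h : B → List A) (xs : List B) f →
                Σ (concatMap h xs) f ≈ Σ xs (λ x → Σ (h x) f)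
  Σ-concatMap h []       f = refl
  Σ-concatMap h (x ∷ xs) f =
    trans (Σ-++ (h x) (concatMap h xs) f) (∙-congˡ (Σ-concatMap h xs f))

  Σ-swap : ∀ (xs : List A) (ys : List B) (f : A → B → C) →
           Σ xs (λ x → Σ ys (f x)) ≈ Σ ys (λ y → Σ xs (λ x → f x y))
  Σ-swap []       ys f = sym (Σ-ε ys)
  Σ-swap (x ∷ xs) ys f =
    trans (∙-congˡ (Σ-swap xs ys f)) (sym (Σ-∙ ys (f x) (λ y → Σ xs (λ x′ → f x′ y))))

module _ {c₁ ℓ₁ c₂ ℓ₂} (M : CommutativeMonoid c₁ ℓ₁) (N : CommutativeMonoid c₂ ℓ₂) where
  private
    module M = CommutativeMonoid M
    module N = CommutativeMonoid N
    module ΣM = ListSum M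
    module ΣN = ListSum N

  Σ-homo : ∀ (h : M.Carrier → N.Carrier) → h M.ε N.≈ N.ε →
           (∀ x y → h (x M.∙ y) N.≈ h x N.∙ h y) →
           ∀ {A : Set} (xs : List A) f → h (ΣM.Σ xs f) N.≈ ΣN.Σ xs (h ∘ f)
  Σ-homo h ε-homo ∙-homo []       f = ε-homo
  Σ-homo h ε-homo ∙-homo (x ∷ xs) f =
    N.trans (∙-homo _ _) (N.∙-congˡ (Σ-homo h ε-homo ∙-homo xs f))

module ℕΣ = ListSum ℕP.+-0-commutativeMonoid
module ℤΣ = ListSum ℤP.+-0-commutativeMonoid

ℤΣ-*ˡ : ∀ {A : Set} c (xs : List A) f → c ℤ.* ℤΣ.Σ xs f ≡ ℤΣ.Σ xs (λ x → c ℤ.* f x)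
ℤΣ-*ˡ c = Σ-homo ℤP.+-0-commutativeMonoid ℤP.+-0-commutativeMonoid
                 (c ℤ.*_) (ℤP.*-zeroʳ c) (ℤP.*-distribˡ-+ c)

ℤΣ-const : ∀ {A : Set} (xs : List A) c → ℤΣ.Σ xs (λ _ → c) ≡ + L.length xs ℤ.* c
ℤΣ-const []       c = ≡.sym (ℤP.*-zeroˡ c)
ℤΣ-const (x ∷ xs) c = begin
  c ℤ.+ ℤΣ.Σ xs (λ _ → c)              ≡⟨ ≡.cong (λ z → c ℤ.+ z) (ℤΣ-const xs c) ⟩
  c ℤ.+ + L.length xs ℤ.* c            ≡⟨ ≡.cong (ℤ._+ + L.length xs ℤ.* c) (ℤP.*-identityˡ c) ⟨
  + 1 ℤ.* c ℤ.+ + L.length xs ℤ.* c    ≡⟨ ℤP.*-distribʳ-+ c (+ 1) (+ L.length xs) ⟨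
  + suc (L.length xs) ℤ.* c            ∎
  where open ≡.≡-Reasoning

private variable
  d n : ℕ

ΣallFin-suc : (f : Fin (suc n) → ℕ) →
              ℕΣ.Σ (L.allFin (suc n)) f ≡ f Fin.zero ℕ.+ ℕΣ.Σ (L.allFin n) (f ∘ Fin.suc)
ΣallFin-suc {n} f = ≡.cong (f Fin.zero ℕ.+_) (≡.trans
  (≡.cong (λ is → ℕΣ.Σ is f) (≡.sym (LP.map-tabulate id Fin.suc))) (ℕΣ.Σ-map Fin.suc (L.allFin n) f))

Σ-allFin-1 : ∀ m → ℕΣ.Σ (L.allFin m) (λ _ → 1) ≡ m
Σ-allFin-1 zero    = ≡.refl
Σ-allFin-1 (suc m) = ≡.trans (ΣallFin-suc {m} (λ _ → 1)) (≡.cong suc (Σ-allFin-1 m))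

χ : Bool → ℕ
χ b = if b then 1 else 0

χ-not : ∀ b → χ (not b) ℕ.+ χ b ≡ 1
χ-not true  = ≡.refl
χ-not false = ≡.refl

Σ-allFin-δ : ∀ {m} (j : Fin m) → ℕΣ.Σ (L.allFin m) (λ i → χ (does (i Fin.≟ j))) ≡ 1
Σ-allFin-δ {suc m} Fin.zero    =
  ≡.trans (ΣallFin-suc {m} (λ i → χ (does (i Fin.≟ Fin.zero)))) (≡.cong suc (ℕΣ.Σ-ε (L.allFin m)))
Σ-allFin-δ {suc m} (Fin.suc j) =
  ≡.trans (ΣallFin-suc {m} (λ i → χ (does (i Fin.≟ Fin.suc j)))) (Σ-allFin-δ j)

Σ-allFin-≡0 : ∀ {m} (f : Fin m → ℕ) → ℕΣ.Σ (L.allFin m) f ≡ 0 → ∀ i → f i ≡ 0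
Σ-allFin-≡0 {suc m} f Σ≡0 Fin.zero    = ℕP.m+n≡0⇒m≡0 (f Fin.zero) (≡.trans (≡.sym (ΣallFin-suc f)) Σ≡0)
Σ-allFin-≡0 {suc m} f Σ≡0 (Fin.suc i) =
  Σ-allFin-≡0 (f ∘ Fin.suc) (ℕP.m+n≡0⇒n≡0 (f Fin.zero) (≡.trans (≡.sym (ΣallFin-suc f)) Σ≡0)) i

map-allFin-suc : ∀ {A : Set} (f : Fin (suc n) → A) →
                 map f (L.allFin (suc n)) ≡ f Fin.zero ∷ map (f ∘ Fin.suc) (L.allFin n)
map-allFin-suc f =
  ≡.cong (f Fin.zero ∷_) (≡.trans (LP.map-tabulate Fin.suc f) (≡.sym (LP.map-tabulate id (f ∘ Fin.suc))))

sum-tabulate : (f : Fin n → ℕ) → V.sum (V.tabulate f) ≡ ℕΣ.Σ (L.allFin n) f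
sum-tabulate {zero}  f = ≡.refl
sum-tabulate {suc n} f = ≡.trans (≡.cong (f Fin.zero ℕ.+_) (sum-tabulate (f ∘ Fin.suc))) (≡.sym (ΣallFin-suc f))

if-+ : ∀ (b : Bool) x y → (if b then x ℕ.+ y else 0) ≡ (if b then x else 0) ℕ.+ (if b then y else 0)
if-+ true  x y = ≡.refl
if-+ false x y = ≡.refl

sum-tabulate-+ : (f g : Fin n → ℕ) →
                 V.sum (V.tabulate (λ i → f i ℕ.+ g i)) ≡ V.sum (V.tabulate f) ℕ.+ V.sum (V.tabulate g)
sum-tabulate-+ {zero}  f g = ≡.refl
sum-tabulate-+ {suc n} f g =
  ≡.trans (≡.cong (f Fin.zero ℕ.+ g Fin.zero ℕ.+_) (sum-tabulate-+ (f ∘ Fin.suc) (g ∘ Fin.suc)))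
          (+-interchange (f Fin.zero) (g Fin.zero) _ _)

zipWith-tabulate : ∀ {A B C : Set} (_∙_ : A → B → C) (f : Fin n → A) g →
                   V.zipWith _∙_ (V.tabulate f) (V.tabulate g) ≡ V.tabulate (λ i → f i ∙ g i)
zipWith-tabulate {zero}  _∙_ f g = ≡.refl
zipWith-tabulate {suc n} _∙_ f g =
  ≡.cong (f Fin.zero ∙ g Fin.zero V.∷_) (zipWith-tabulate _∙_ (f ∘ Fin.suc) (g ∘ Fin.suc))

tabulate-const : ∀ {A : Set} (x : A) → V.tabulate {n = n} (λ _ → x) ≡ replicate n x
tabulate-const {zero}  x = ≡.refl
tabulate-const {suc n} x = ≡.cong (x V.∷_) (tabulate-const x)

sum-replicate-0 : ∀ n → V.sum (replicate n 0) ≡ 0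
sum-replicate-0 zero    = ≡.refl
sum-replicate-0 (suc n) = sum-replicate-0 n

infixl 6 _⊕_ _⊖_
infix 4 _≤ᴹ_ _≟ᴹ_

_⊕_ : Mono d → Mono d → Mono d
a ⊕ b = V.zipWith ℕ._+_ (proj₁ a) (proj₁ b) , proj₂ a ℕ.+ proj₂ b

_⊖_ : Mono d → Mono d → Mono d
m ⊖ a = V.zipWith ℕ._∸_ (proj₁ m) (proj₁ a) , proj₂ m ℕ.∸ proj₂ a

1ᴹ : Mono d
1ᴹ {d} = replicate d 0 , 0

_≤ᴹ_ : Mono d → Mono d → Set
a ≤ᴹ m = Pointwise ℕ._≤_ (proj₁ a) (proj₁ m) × proj₂ a ℕ.≤ proj₂ m

_≤ᴹ?_ : (a m : Mono d) → Dec (a ≤ᴹ m)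
a ≤ᴹ? m = Pointwise.decidable ℕP._≤?_ (proj₁ a) (proj₁ m) ×-dec (proj₂ a ℕP.≤? proj₂ m)

_≟ᴹ_ : (a m : Mono d) → Dec (a ≡ m)
a ≟ᴹ m = ×P.≡-dec (VP.≡-dec ℕ._≟_) ℕ._≟_ a m

⊕-comm : (a b : Mono d) → a ⊕ b ≡ b ⊕ a
⊕-comm a b = ≡.cong₂ _,_ (VP.zipWith-comm ℕP.+-comm (proj₁ a) (proj₁ b)) (ℕP.+-comm (proj₂ a) (proj₂ b))

⊕-assoc : (a b c : Mono d) → a ⊕ b ⊕ c ≡ a ⊕ (b ⊕ c)
⊕-assoc a b c = ≡.cong₂ _,_ (VP.zipWith-assoc ℕP.+-assoc (proj₁ a) (proj₁ b) (proj₁ c))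
                            (ℕP.+-assoc (proj₂ a) (proj₂ b) (proj₂ c))

⊕-identityˡ : (a : Mono d) → 1ᴹ ⊕ a ≡ a
⊕-identityˡ a = ≡.cong (_, proj₂ a) (VP.zipWith-identityˡ ℕP.+-identityˡ (proj₁ a))

≤-zipWith-+ : (a b : Vec ℕ n) → Pointwise ℕ._≤_ a (V.zipWith ℕ._+_ a b)
≤-zipWith-+ V.[]       V.[]       = []
≤-zipWith-+ (x V.∷ a) (y V.∷ b) = ℕP.m≤m+n x y ∷ ≤-zipWith-+ a b

zipWith-+-∸ : (a b : Vec ℕ n) → V.zipWith ℕ._∸_ (V.zipWith ℕ._+_ a b) a ≡ b
zipWith-+-∸ V.[]       V.[]       = ≡.refl
zipWith-+-∸ (x V.∷ a) (y V.∷ b) = ≡.cong₂ V._∷_ (ℕP.m+n∸m≡n x y) (zipWith-+-∸ a b)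

zipWith-+-∸-≤ : {a m : Vec ℕ n} → Pointwise ℕ._≤_ a m → V.zipWith ℕ._+_ a (V.zipWith ℕ._∸_ m a) ≡ m
zipWith-+-∸-≤ []          = ≡.refl
zipWith-+-∸-≤ (x≤y ∷ a≤m) = ≡.cong₂ V._∷_ (ℕP.m+[n∸m]≡n x≤y) (zipWith-+-∸-≤ a≤m)

≤ᴹ-⊕ : (a b : Mono d) → a ≤ᴹ a ⊕ b
≤ᴹ-⊕ a b = ≤-zipWith-+ (proj₁ a) (proj₁ b) , ℕP.m≤m+n (proj₂ a) (proj₂ b)

⊕-⊖-cancel : (a b : Mono d) → a ⊕ b ⊖ a ≡ b
⊕-⊖-cancel a b = ≡.cong₂ _,_ (zipWith-+-∸ (proj₁ a) (proj₁ b)) (ℕP.m+n∸m≡n (proj₂ a) (proj₂ b))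

⊕-⊖-≤ : {a m : Mono d} → a ≤ᴹ m → a ⊕ (m ⊖ a) ≡ m
⊕-⊖-≤ (a≤m , k≤j) = ≡.cong₂ _,_ (zipWith-+-∸-≤ a≤m) (ℕP.m+[n∸m]≡n k≤j)

⊕-≡⇔ : ∀ {a m : Mono d} b → a ≤ᴹ m → (a ⊕ b ≡ m) ⇔ (b ≡ m ⊖ a)
⊕-≡⇔ {a = a} b a≤m = mk⇔ (λ e → ≡.trans (≡.sym (⊕-⊖-cancel a b)) (≡.cong (_⊖ a) e))
                         (λ e → ≡.trans (≡.cong (a ⊕_) e) (⊕-⊖-≤ a≤m))

monoEq-does : (a m : Mono d) (a≟m : Dec (a ≡ m)) → monoEq a m ≡ does a≟m
monoEq-does a m a≟m = ≡.trans (≡.cong₂ _∧_ (isYes≗does exps?) (isYes≗does deg?))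
                               (does-⇔ (mk⇔ (uncurry (≡.cong₂ _,_)) ×P.,-injective) (exps? ×-dec deg?) a≟m)
  where
  exps? = VP.≡-dec ℕ._≟_ (proj₁ a) (proj₁ m)
  deg?  = proj₂ a ℕ.≟ proj₂ m

monoEq-⊕-≤ : ∀ {a m : Mono d} b → a ≤ᴹ m → monoEq (a ⊕ b) m ≡ monoEq b (m ⊖ a)
monoEq-⊕-≤ {a = a} {m} b a≤m = ≡.trans (monoEq-does (a ⊕ b) m (map′ from to (b ≟ᴹ m ⊖ a)))
                                        (≡.sym (monoEq-does b (m ⊖ a) (b ≟ᴹ m ⊖ a)))
  where open Equivalence (⊕-≡⇔ b a≤m)

monoEq-⊕-≰ : ∀ {a m : Mono d} b → ¬ a ≤ᴹ m → monoEq (a ⊕ b) m ≡ false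
monoEq-⊕-≰ {a = a} {m} b a≰m =
  monoEq-does (a ⊕ b) m (no λ a⊕b≡m → a≰m (≡.subst (a ≤ᴹ_) a⊕b≡m (≤ᴹ-⊕ a b)))

-- By definition coeff P m is ℤΣ.Σ P (coeffAt m), and P *P Q is concatMap (λ s → map (s ·ᵗ_) Q) P.

coeffAt : Mono d → ℤ × Mono d → ℤ
coeffAt m t = if monoEq (proj₂ t) m then proj₁ t else + 0

infixl 7 _·ᵗ_
_·ᵗ_ : ℤ × Mono d → ℤ × Mono d → ℤ × Mono d
s ·ᵗ t = proj₁ s ℤ.* proj₁ t , proj₂ s ⊕ proj₂ t

if-*ʳ : ∀ (b : Bool) c x → (if b then c ℤ.* x else + 0) ≡ c ℤ.* (if b then x else + 0)
if-*ʳ true  c x = ≡.refl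
if-*ʳ false c x = ≡.sym (ℤP.*-zeroʳ c)

coeffAt-·ᵗ-≤ : ∀ {a m : Mono d} c t → a ≤ᴹ m → coeffAt m ((c , a) ·ᵗ t) ≡ c ℤ.* coeffAt (m ⊖ a) t
coeffAt-·ᵗ-≤ c t a≤m rewrite monoEq-⊕-≤ (proj₂ t) a≤m = if-*ʳ _ c (proj₁ t)

coeffAt-·ᵗ-≰ : ∀ {a m : Mono d} c t → ¬ a ≤ᴹ m → coeffAt m ((c , a) ·ᵗ t) ≡ + 0
coeffAt-·ᵗ-≰ c t a≰m rewrite monoEq-⊕-≰ (proj₂ t) a≰m = ≡.refl

·ᵗ-comm : (s t : ℤ × Mono d) → s ·ᵗ t ≡ t ·ᵗ s
·ᵗ-comm s t = ≡.cong₂ _,_ (ℤP.*-comm (proj₁ s) (proj₁ t)) (⊕-comm (proj₂ s) (proj₂ t))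

·ᵗ-assoc : (s t u : ℤ × Mono d) → s ·ᵗ t ·ᵗ u ≡ s ·ᵗ (t ·ᵗ u)
·ᵗ-assoc s t u = ≡.cong₂ _,_ (ℤP.*-assoc (proj₁ s) (proj₁ t) (proj₁ u)) (⊕-assoc (proj₂ s) (proj₂ t) (proj₂ u))

·ᵗ-identityˡ : (t : ℤ × Mono d) → (+ 1 , 1ᴹ) ·ᵗ t ≡ t
·ᵗ-identityˡ t = ≡.cong₂ _,_ (ℤP.*-identityˡ (proj₁ t)) (⊕-identityˡ (proj₂ t))

Σ-*P : ∀ (P Q : Poly d) f → ℤΣ.Σ (P *P Q) f ≡ ℤΣ.Σ P (λ s → ℤΣ.Σ Q (λ t → f (s ·ᵗ t)))
Σ-*P P Q f = ≡.trans (ℤΣ.Σ-concatMap (λ s → map (s ·ᵗ_) Q) P f)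
                     (ℤΣ.Σ-cong P (λ s → ℤΣ.Σ-map (s ·ᵗ_) Q f))

Σ-coeffAt-·ᵗ-≤ : ∀ {a m : Mono d} c (Q : Poly d) → a ≤ᴹ m →
                 ℤΣ.Σ Q (λ t → coeffAt m ((c , a) ·ᵗ t)) ≡ c ℤ.* coeff Q (m ⊖ a)
Σ-coeffAt-·ᵗ-≤ c Q a≤m = ≡.trans (ℤΣ.Σ-cong Q (λ t → coeffAt-·ᵗ-≤ c t a≤m)) (≡.sym (ℤΣ-*ˡ c Q _))

Σ-coeffAt-·ᵗ-≰ : ∀ {a m : Mono d} c (Q : Poly d) → ¬ a ≤ᴹ m →
                 ℤΣ.Σ Q (λ t → coeffAt m ((c , a) ·ᵗ t)) ≡ + 0
Σ-coeffAt-·ᵗ-≰ c Q a≰m = ≡.trans (ℤΣ.Σ-cong Q (λ t → coeffAt-·ᵗ-≰ c t a≰m)) (ℤΣ.Σ-ε Q)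

infix 4 _≋_
record _≋_ (P Q : Poly d) : Set where
  constructor mk≋
  field coeff-≡ : ∀ m → coeff P m ≡ coeff Q m
open _≋_

≋-isEquivalence : IsEquivalence (_≋_ {d})
≋-isEquivalence = record
  { refl  = mk≋ λ m → ≡.refl
  ; sym   = λ P≋Q → mk≋ λ m → ≡.sym (coeff-≡ P≋Q m)
  ; trans = λ P≋Q Q≋R → mk≋ λ m → ≡.trans (coeff-≡ P≋Q m) (coeff-≡ Q≋R m)
  }

module ≋ {d} = IsEquivalence (≋-isEquivalence {d})

≡⇒≋ : {P Q : Poly d} → P ≡ Q → P ≋ Q
≡⇒≋ ≡.refl = ≋.refl

≋-setoid : ℕ → Setoid 0ℓ 0ℓ
≋-setoid d = record { isEquivalence = ≋-isEquivalence {d} }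

coeff-++ : ∀ (P Q : Poly d) m → coeff (P +P Q) m ≡ coeff P m ℤ.+ coeff Q m
coeff-++ P Q m = ℤΣ.Σ-++ P Q (coeffAt m)

+P-cong : {P P′ Q Q′ : Poly d} → P ≋ P′ → Q ≋ Q′ → P +P Q ≋ P′ +P Q′
+P-cong {P = P} {P′} {Q} {Q′} P≋P′ Q≋Q′ = mk≋ λ m → begin
  coeff (P +P Q) m             ≡⟨ coeff-++ P Q m ⟩
  coeff P m ℤ.+ coeff Q m      ≡⟨ ≡.cong₂ ℤ._+_ (coeff-≡ P≋P′ m) (coeff-≡ Q≋Q′ m) ⟩
  coeff P′ m ℤ.+ coeff Q′ m    ≡⟨ coeff-++ P′ Q′ m ⟨
  coeff (P′ +P Q′) m           ∎
  where open ≡.≡-Reasoning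

+P-comm : (P Q : Poly d) → P +P Q ≋ Q +P P
+P-comm P Q = mk≋ λ m → ≡.trans (coeff-++ P Q m)
                        (≡.trans (ℤP.+-comm (coeff P m) (coeff Q m)) (≡.sym (coeff-++ Q P m)))

+P-assoc : (P Q R : Poly d) → (P +P Q) +P R ≋ P +P (Q +P R)
+P-assoc P Q R = ≡⇒≋ (LP.++-assoc P Q R)

+P-commutativeMonoid : ℕ → CommutativeMonoid 0ℓ 0ℓ
+P-commutativeMonoid d = record
  { Carrier = Poly d ; _≈_ = _≋_ ; _∙_ = _+P_ ; ε = 0P
  ; isCommutativeMonoid = isCommutativeMonoidˡ record
    { isSemigroup = record
      { isMagma = record { isEquivalence = ≋-isEquivalence ; ∙-cong = +P-cong }
      ; assoc   = +P-assoc }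
    ; identityˡ = λ P → ≋.refl
    ; comm      = +P-comm }
  }

*P-congʳ : (P : Poly d) {Q Q′ : Poly d} → Q ≋ Q′ → P *P Q ≋ P *P Q′
*P-congʳ P {Q} {Q′} Q≋Q′ = mk≋ λ m →
  ≡.trans (Σ-*P P Q (coeffAt m)) (≡.trans (ℤΣ.Σ-cong P (row m)) (≡.sym (Σ-*P P Q′ (coeffAt m))))
  where
  row : ∀ m s → ℤΣ.Σ Q (λ t → coeffAt m (s ·ᵗ t)) ≡ ℤΣ.Σ Q′ (λ t → coeffAt m (s ·ᵗ t))
  row m (c , a) with a ≤ᴹ? m
  ... | yes a≤m = begin
    ℤΣ.Σ Q (λ t → coeffAt m ((c , a) ·ᵗ t))    ≡⟨ Σ-coeffAt-·ᵗ-≤ c Q a≤m ⟩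
    c ℤ.* coeff Q (m ⊖ a)                      ≡⟨ ≡.cong (c ℤ.*_) (coeff-≡ Q≋Q′ (m ⊖ a)) ⟩
    c ℤ.* coeff Q′ (m ⊖ a)                     ≡⟨ Σ-coeffAt-·ᵗ-≤ c Q′ a≤m ⟨
    ℤΣ.Σ Q′ (λ t → coeffAt m ((c , a) ·ᵗ t))   ∎
    where open ≡.≡-Reasoning
  ... | no a≰m = ≡.trans (Σ-coeffAt-·ᵗ-≰ c Q a≰m) (≡.sym (Σ-coeffAt-·ᵗ-≰ c Q′ a≰m))

*P-comm : (P Q : Poly d) → P *P Q ≋ Q *P P
*P-comm P Q = mk≋ λ m → begin
  coeff (P *P Q) m
    ≡⟨ Σ-*P P Q (coeffAt m) ⟩
  ℤΣ.Σ P (λ s → ℤΣ.Σ Q (λ t → coeffAt m (s ·ᵗ t)))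
    ≡⟨ ℤΣ.Σ-swap P Q (λ s t → coeffAt m (s ·ᵗ t)) ⟩
  ℤΣ.Σ Q (λ t → ℤΣ.Σ P (λ s → coeffAt m (s ·ᵗ t)))
    ≡⟨ ℤΣ.Σ-cong Q (λ t → ℤΣ.Σ-cong P (λ s → ≡.cong (coeffAt m) (·ᵗ-comm s t))) ⟩
  ℤΣ.Σ Q (λ t → ℤΣ.Σ P (λ s → coeffAt m (t ·ᵗ s)))
    ≡⟨ Σ-*P Q P (coeffAt m) ⟨
  coeff (Q *P P) m ∎
  where open ≡.≡-Reasoning

*P-assoc : (P Q R : Poly d) → (P *P Q) *P R ≋ P *P (Q *P R)
*P-assoc P Q R = mk≋ λ m → begin
  coeff ((P *P Q) *P R) m
    ≡⟨ Σ-*P (P *P Q) R (coeffAt m) ⟩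
  ℤΣ.Σ (P *P Q) (λ u → ℤΣ.Σ R (λ r → coeffAt m (u ·ᵗ r)))
    ≡⟨ Σ-*P P Q (λ u → ℤΣ.Σ R (λ r → coeffAt m (u ·ᵗ r))) ⟩
  ℤΣ.Σ P (λ s → ℤΣ.Σ Q (λ t → ℤΣ.Σ R (λ r → coeffAt m (s ·ᵗ t ·ᵗ r))))
    ≡⟨ ℤΣ.Σ-cong P (λ s → ℤΣ.Σ-cong Q λ t → ℤΣ.Σ-cong R λ r → ≡.cong (coeffAt m) (·ᵗ-assoc s t r)) ⟩
  ℤΣ.Σ P (λ s → ℤΣ.Σ Q (λ t → ℤΣ.Σ R (λ r → coeffAt m (s ·ᵗ (t ·ᵗ r)))))
    ≡⟨ ℤΣ.Σ-cong P (λ s → Σ-*P Q R (λ w → coeffAt m (s ·ᵗ w))) ⟨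
  ℤΣ.Σ P (λ s → ℤΣ.Σ (Q *P R) (λ w → coeffAt m (s ·ᵗ w)))
    ≡⟨ Σ-*P P (Q *P R) (coeffAt m) ⟨
  coeff (P *P (Q *P R)) m ∎
  where open ≡.≡-Reasoning

*P-identityˡ : (P : Poly d) → 1P *P P ≋ P
*P-identityˡ P = mk≋ λ m → begin
  coeff (1P *P P) m                                    ≡⟨ Σ-*P 1P P (coeffAt m) ⟩
  ℤΣ.Σ P (λ t → coeffAt m ((+ 1 , 1ᴹ) ·ᵗ t)) ℤ.+ + 0   ≡⟨ ℤP.+-identityʳ _ ⟩
  ℤΣ.Σ P (λ t → coeffAt m ((+ 1 , 1ᴹ) ·ᵗ t))           ≡⟨ ℤΣ.Σ-cong P (λ t → ≡.cong (coeffAt m) (·ᵗ-identityˡ t)) ⟩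
  coeff P m                                            ∎
  where open ≡.≡-Reasoning

*P-distribˡ : (P Q R : Poly d) → P *P (Q +P R) ≋ (P *P Q) +P (P *P R)
*P-distribˡ {d} P Q R = mk≋ λ m → begin
  coeff (P *P (Q +P R)) m
    ≡⟨ Σ-*P P (Q +P R) (coeffAt m) ⟩
  ℤΣ.Σ P (row m (Q ++ R))
    ≡⟨ ℤΣ.Σ-cong P (λ s → ℤΣ.Σ-++ Q R (λ t → coeffAt m (s ·ᵗ t))) ⟩
  ℤΣ.Σ P (λ s → row m Q s ℤ.+ row m R s)
    ≡⟨ ℤΣ.Σ-∙ P (row m Q) (row m R) ⟩
  ℤΣ.Σ P (row m Q) ℤ.+ ℤΣ.Σ P (row m R)
    ≡⟨ ≡.cong₂ ℤ._+_ (Σ-*P P Q (coeffAt m)) (Σ-*P P R (coeffAt m)) ⟨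
  coeff (P *P Q) m ℤ.+ coeff (P *P R) m
    ≡⟨ coeff-++ (P *P Q) (P *P R) m ⟨
  coeff ((P *P Q) +P (P *P R)) m ∎
  where
  open ≡.≡-Reasoning
  row : Mono d → Poly d → ℤ × Mono d → ℤ
  row m X s = ℤΣ.Σ X (λ t → coeffAt m (s ·ᵗ t))

*P-zeroʳ : (P : Poly d) → P *P 0P ≋ 0P
*P-zeroʳ P = mk≋ λ m → ≡.trans (Σ-*P P 0P (coeffAt m)) (ℤΣ.Σ-ε P)

*P-congˡ : {P P′ : Poly d} (Q : Poly d) → P ≋ P′ → P *P Q ≋ P′ *P Q
*P-congˡ {P = P} {P′} Q P≋P′ = ≋.trans (*P-comm P Q) (≋.trans (*P-congʳ Q P≋P′) (*P-comm Q P′))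

*P-cong : {P P′ Q Q′ : Poly d} → P ≋ P′ → Q ≋ Q′ → P *P Q ≋ P′ *P Q′
*P-cong {P′ = P′} {Q} P≋P′ Q≋Q′ = ≋.trans (*P-congˡ Q P≋P′) (*P-congʳ P′ Q≋Q′)

*P-distribʳ : (P Q R : Poly d) → (P +P Q) *P R ≋ (P *P R) +P (Q *P R)
*P-distribʳ P Q R = ≋.trans (*P-comm (P +P Q) R)
                    (≋.trans (*P-distribˡ R P Q) (+P-cong (*P-comm R P) (*P-comm R Q)))

*P-identityʳ : (P : Poly d) → P *P 1P ≋ P
*P-identityʳ P = ≋.trans (*P-comm P 1P) (*P-identityˡ P)

*P-commutativeMonoid : ℕ → CommutativeMonoid 0ℓ 0ℓ
*P-commutativeMonoid d = record
  { Carrier = Poly d ; _≈_ = _≋_ ; _∙_ = _*P_ ; ε = 1P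
  ; isCommutativeMonoid = isCommutativeMonoidˡ record
    { isSemigroup = record
      { isMagma = record { isEquivalence = ≋-isEquivalence ; ∙-cong = *P-cong }
      ; assoc   = *P-assoc }
    ; identityˡ = *P-identityˡ
    ; comm      = *P-comm }
  }

*P-interchange : (A B C D : Poly d) → (A *P B) *P (C *P D) ≋ (A *P C) *P (B *P D)
*P-interchange {d} = interchange
  where open import Algebra.Properties.CommutativeSemigroup
                      (CommutativeMonoid.commutativeSemigroup (*P-commutativeMonoid d))

coeff-neg : ∀ (P : Poly d) m → coeff (-P P) m ≡ ℤ.- coeff P m
coeff-neg P m = begin
  coeff (-P P) m                                       ≡⟨ ℤΣ.Σ-map _ P (coeffAt m) ⟩
  ℤΣ.Σ P (λ t → coeffAt m (ℤ.- proj₁ t , proj₂ t))     ≡⟨ ℤΣ.Σ-cong P coeffAt-neg ⟩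
  ℤΣ.Σ P (λ t → ℤ.- coeffAt m t)                       ≡⟨ Σ-homo ℤP.+-0-commutativeMonoid ℤP.+-0-commutativeMonoid
                                                                 ℤ.-_ ≡.refl ℤP.neg-distrib-+ P (coeffAt m) ⟨
  ℤ.- coeff P m                                        ∎
  where
  open ≡.≡-Reasoning
  coeffAt-neg : ∀ t → coeffAt m (ℤ.- proj₁ t , proj₂ t) ≡ ℤ.- coeffAt m t
  coeffAt-neg t with monoEq (proj₂ t) m
  ... | true  = ≡.refl
  ... | false = ≡.refl

-P-+P-cancel : (P Q : Poly d) → (P -P Q) +P Q ≋ P
-P-+P-cancel P Q = mk≋ λ m → begin
  coeff ((P -P Q) +P Q) m                        ≡⟨ ≡.trans (coeff-++ (P -P Q) Q m)
                                                      (≡.cong (ℤ._+ coeff Q m) (coeff-++ P (-P Q) m)) ⟩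
  coeff P m ℤ.+ coeff (-P Q) m ℤ.+ coeff Q m     ≡⟨ ≡.cong (λ z → coeff P m ℤ.+ z ℤ.+ coeff Q m) (coeff-neg Q m) ⟩
  coeff P m ℤ.+ ℤ.- coeff Q m ℤ.+ coeff Q m      ≡⟨ ℤP.+-assoc (coeff P m) _ _ ⟩
  coeff P m ℤ.+ (ℤ.- coeff Q m ℤ.+ coeff Q m)    ≡⟨ ≡.cong (λ z → coeff P m ℤ.+ z) (ℤP.+-inverseˡ (coeff Q m)) ⟩
  coeff P m ℤ.+ + 0                              ≡⟨ ℤP.+-identityʳ (coeff P m) ⟩
  coeff P m                                      ∎
  where open ≡.≡-Reasoning

module ΣP {d} = ListSum (+P-commutativeMonoid d)
module ΠP {d} = ListSum (*P-commutativeMonoid d)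

sumP-map : ∀ {A : Set} (f : A → Poly d) xs → sumP (map f xs) ≡ ΣP.Σ xs f
sumP-map f xs = LP.foldr-map _+P_ f 0P xs

prodP-map : ∀ {A : Set} (f : A → Poly d) xs → prodP (map f xs) ≡ ΠP.Σ xs f
prodP-map f xs = LP.foldr-map _*P_ f 1P xs

prodP-allFin-suc : (f : Fin (suc n) → Poly d) →
                   prodP (map f (L.allFin (suc n))) ≡ f Fin.zero *P prodP (map (f ∘ Fin.suc) (L.allFin n))
prodP-allFin-suc f = ≡.cong prodP (map-allFin-suc f)

coeff-ΣP : ∀ {A : Set} (xs : List A) (f : A → Poly d) m →
           coeff (ΣP.Σ xs f) m ≡ ℤΣ.Σ xs (λ x → coeff (f x) m)
coeff-ΣP xs f m = Σ-homo (+P-commutativeMonoid _) ℤP.+-0-commutativeMonoid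
                         (λ P → coeff P m) ≡.refl (λ P Q → coeff-++ P Q m) xs f

*P-ΣP : ∀ {A : Set} (P : Poly d) (xs : List A) f → P *P ΣP.Σ xs f ≋ ΣP.Σ xs (λ x → P *P f x)
*P-ΣP P = Σ-homo (+P-commutativeMonoid _) (+P-commutativeMonoid _) (P *P_) (*P-zeroʳ P) (*P-distribˡ P)

ΣP-*P : ∀ {A : Set} (P : Poly d) (xs : List A) f → ΣP.Σ xs f *P P ≋ ΣP.Σ xs (λ x → f x *P P)
ΣP-*P P xs f = ≋.trans (*P-comm _ P)
               (≋.trans (*P-ΣP P xs f) (ΣP.Σ-cong xs (λ x → *P-comm P (f x))))

constP : ℤ → Poly d
constP c = (c , 1ᴹ) ∷ []

coeff-scale : ∀ c (P : Poly d) m → coeff (scale c P) m ≡ c ℤ.* coeff P m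
coeff-scale c P m = begin
  coeff (scale c P) m                                              ≡⟨ ℤΣ.Σ-map _ P (coeffAt m) ⟩
  ℤΣ.Σ P (λ t → if monoEq (proj₂ t) m then c ℤ.* proj₁ t else + 0)  ≡⟨ ℤΣ.Σ-cong P (λ t → if-*ʳ _ c (proj₁ t)) ⟩
  ℤΣ.Σ P (λ t → c ℤ.* coeffAt m t)                                  ≡⟨ ℤΣ-*ˡ c P (coeffAt m) ⟨
  c ℤ.* coeff P m                                                  ∎
  where open ≡.≡-Reasoning

scale-cong : ∀ c {P Q : Poly d} → P ≋ Q → scale c P ≋ scale c Q
scale-cong c {P} {Q} P≋Q = mk≋ λ m →
  ≡.trans (coeff-scale c P m) (≡.trans (≡.cong (c ℤ.*_) (coeff-≡ P≋Q m)) (≡.sym (coeff-scale c Q m)))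

scale-≋ : ∀ c (P : Poly d) → scale c P ≋ constP c *P P
scale-≋ c P = mk≋ λ m → ≡.sym (begin
  coeff (constP c *P P) m                             ≡⟨ Σ-*P (constP c) P (coeffAt m) ⟩
  ℤΣ.Σ P (λ t → coeffAt m ((c , 1ᴹ) ·ᵗ t)) ℤ.+ + 0     ≡⟨ ℤP.+-identityʳ _ ⟩
  ℤΣ.Σ P (λ t → coeffAt m ((c , 1ᴹ) ·ᵗ t))            ≡⟨ ℤΣ.Σ-cong P (λ t → ≡.cong (λ a → coeffAt m (_ , a))
                                                                               (⊕-identityˡ (proj₂ t))) ⟩
  ℤΣ.Σ P (λ t → coeffAt m (c ℤ.* proj₁ t , proj₂ t))   ≡⟨ ℤΣ.Σ-map _ P (coeffAt m) ⟨
  coeff (scale c P) m                                 ∎)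
  where open ≡.≡-Reasoning

scale-*P : ∀ c (P Q : Poly d) → scale c P *P Q ≋ scale c (P *P Q)
scale-*P c P Q = ≋.trans (*P-congˡ Q (scale-≋ c P))
                 (≋.trans (*P-assoc (constP c) P Q) (≋.sym (scale-≋ c (P *P Q))))

scale-ΣP : ∀ {A : Set} c (xs : List A) (f : A → Poly d) → scale c (ΣP.Σ xs f) ≋ ΣP.Σ xs (scale c ∘ f)
scale-ΣP c = Σ-homo (+P-commutativeMonoid _) (+P-commutativeMonoid _) (scale c) ≋.refl
                    (λ P Q → ≡⇒≋ (LP.map-++ _ P Q))

scale-scale : ∀ a c (P : Poly d) → scale a (scale c P) ≋ scale (a ℤ.* c) P
scale-scale a c P = mk≋ λ m → begin
  coeff (scale a (scale c P)) m    ≡⟨ ≡.trans (coeff-scale a (scale c P) m) (≡.cong (a ℤ.*_) (coeff-scale c P m)) ⟩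
  a ℤ.* (c ℤ.* coeff P m)          ≡⟨ ℤP.*-assoc a c (coeff P m) ⟨
  a ℤ.* c ℤ.* coeff P m            ≡⟨ coeff-scale (a ℤ.* c) P m ⟨
  coeff (scale (a ℤ.* c) P) m      ∎
  where open ≡.≡-Reasoning

ΣP-const : ∀ {A : Set} (xs : List A) (P : Poly d) → ΣP.Σ xs (λ _ → P) ≋ scale (+ L.length xs) P
ΣP-const xs P = mk≋ λ m → ≡.trans (coeff-ΣP xs (λ _ → P) m)
                          (≡.trans (ℤΣ-const xs (coeff P m)) (≡.sym (coeff-scale (+ L.length xs) P m)))

actMono-⊕ : ∀ (σ : Vec (Fin d) d) a b → actMono σ (a ⊕ b) ≡ actMono σ a ⊕ actMono σ b
actMono-⊕ σ a b = ≡.cong (_, _) (≡.trans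
  (VP.tabulate-cong λ j → ≡.trans (≡.cong V.sum (VP.tabulate-cong (select-+ j)))
                                  (sum-tabulate-+ (select (proj₁ a) j) (select (proj₁ b) j)))
  (≡.sym (zipWith-tabulate ℕ._+_ (V.sum ∘ V.tabulate ∘ select (proj₁ a)) (V.sum ∘ V.tabulate ∘ select (proj₁ b)))))
  where
  select : Vec ℕ _ → Fin _ → Fin _ → ℕ
  select e j i = if isYes (V.lookup σ i Fin.≟ j) then V.lookup e i else 0
  select-+ : ∀ j i → select (V.zipWith ℕ._+_ (proj₁ a) (proj₁ b)) j i ≡ select (proj₁ a) j i ℕ.+ select (proj₁ b) j i
  select-+ j i = ≡.trans (≡.cong (λ x → if isYes (V.lookup σ i Fin.≟ j) then x else 0)
                                 (VP.lookup-zipWith ℕ._+_ i (proj₁ a) (proj₁ b)))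
                         (if-+ _ (V.lookup (proj₁ a) i) (V.lookup (proj₁ b) i))

actMono-θ : ∀ (σ : Vec (Fin d) d) k → actMono σ (replicate d 0 , k) ≡ (replicate d 0 , k)
actMono-θ {d} σ k = ≡.cong (_, k) (≡.trans
  (VP.tabulate-cong λ j → ≡.trans (≡.cong V.sum (≡.trans (VP.tabulate-cong (select-0 j)) (tabulate-const 0)))
                                  (sum-replicate-0 d))
  (tabulate-const 0))
  where
  select-0 : ∀ j i → (if isYes (V.lookup σ i Fin.≟ j) then V.lookup (replicate d 0) i else 0) ≡ 0
  select-0 j i with isYes (V.lookup σ i Fin.≟ j)
  ... | true  = VP.lookup-replicate i 0
  ... | false = ≡.refl

actᵗ : Vec (Fin d) d → ℤ × Mono d → ℤ × Mono d
actᵗ σ t = proj₁ t , actMono σ (proj₂ t)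

actᵗ-·ᵗ : ∀ (σ : Vec (Fin d) d) s t → actᵗ σ (s ·ᵗ t) ≡ actᵗ σ s ·ᵗ actᵗ σ t
actᵗ-·ᵗ σ s t = ≡.cong (proj₁ s ℤ.* proj₁ t ,_) (actMono-⊕ σ (proj₂ s) (proj₂ t))

act-+P : ∀ (σ : Vec (Fin d) d) P Q → act σ (P +P Q) ≡ act σ P +P act σ Q
act-+P σ = LP.map-++ (actᵗ σ)

act--P : ∀ (σ : Vec (Fin d) d) P → act σ (-P P) ≡ -P act σ P
act--P σ P = ≡.trans (≡.sym (LP.map-∘ P)) (LP.map-∘ P)

act-*P : ∀ (σ : Vec (Fin d) d) P Q → act σ (P *P Q) ≡ act σ P *P act σ Q
act-*P σ []      Q = ≡.refl
act-*P σ (s ∷ P) Q = begin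
  act σ (map (s ·ᵗ_) Q +P (P *P Q))               ≡⟨ act-+P σ (map (s ·ᵗ_) Q) (P *P Q) ⟩
  act σ (map (s ·ᵗ_) Q) +P act σ (P *P Q)         ≡⟨ ≡.cong₂ _+P_ row (act-*P σ P Q) ⟩
  map (actᵗ σ s ·ᵗ_) (act σ Q) +P (act σ P *P act σ Q)  ∎
  where
  open ≡.≡-Reasoning
  row : act σ (map (s ·ᵗ_) Q) ≡ map (actᵗ σ s ·ᵗ_) (act σ Q)
  row = ≡.trans (≡.sym (LP.map-∘ Q)) (≡.trans (LP.map-cong (actᵗ-·ᵗ σ s) Q) (LP.map-∘ Q))

act-θ^ : ∀ (σ : Vec (Fin d) d) k → act σ (θ^ k) ≡ θ^ k
act-θ^ σ k = ≡.cong (λ a → (+ 1 , a) ∷ []) (actMono-θ σ k)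

act-prodP : ∀ (σ : Vec (Fin d) d) Ps → act σ (prodP Ps) ≡ prodP (map (act σ) Ps)
act-prodP σ []       = act-θ^ σ 0
act-prodP σ (P ∷ Ps) = ≡.trans (act-*P σ P (prodP Ps)) (≡.cong (act σ P *P_) (act-prodP σ Ps))

act-prodP-map : ∀ {A : Set} (σ : Vec (Fin d) d) (f : A → Poly d) xs →
                act σ (prodP (map f xs)) ≡ prodP (map (act σ ∘ f) xs)
act-prodP-map σ f xs = ≡.trans (act-prodP σ (map f xs)) (≡.cong prodP (≡.sym (LP.map-∘ xs)))

-- The expansion identity

-- Pν p ν is Pθ p X ν by definition; θcompl′ is θcompl with the number of variables d
-- decoupled from the length of ν, so that the expansion can be proved by induction on that length.

module _ (p : ℕ) where

  θfall : Poly d → ℕ → Poly d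
  θfall y v = prodP (map (λ j → y -P θ^ (p ℕ.^ j)) (L.upTo v))

  Pθ : (Fin n → Poly d) → Vec ℕ n → Poly d
  Pθ {n = n} Y ν = prodP (map (λ i → θfall (Y i) (V.lookup ν i)) (L.allFin n))

  θcompl′ : Vec ℕ n → Vec Bool n → Poly d
  θcompl′ {n = n} ν I = prodP (map (λ j → if V.lookup I j then 1P else θ^ (p ℕ.^ V.lookup ν j)) (L.allFin n))

  Pθ-∷ : ∀ (Y : Fin (suc n) → Poly d) v ν → Pθ Y (v V.∷ ν) ≡ θfall (Y Fin.zero) v *P Pθ (Y ∘ Fin.suc) ν
  Pθ-∷ Y v ν = prodP-allFin-suc (λ i → θfall (Y i) (V.lookup (v V.∷ ν) i))

  θcompl′-∷ : ∀ v (ν : Vec ℕ n) b I →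
              θcompl′ {d = d} (v V.∷ ν) (b V.∷ I) ≡ (if b then 1P else θ^ (p ℕ.^ v)) *P θcompl′ ν I
  θcompl′-∷ v ν b I = prodP-allFin-suc (λ j → if V.lookup (b V.∷ I) j then 1P else θ^ (p ℕ.^ V.lookup (v V.∷ ν) j))

  θfall-suc : ∀ (y : Poly d) v → θfall y (suc v) ≋ θfall y v *P (y -P θ^ (p ℕ.^ v))
  θfall-suc y v = begin
    θfall y (suc v)                      ≡⟨ ≡.cong (prodP ∘ map factor) (LP.upTo-∷ʳ v) ⟨
    prodP (map factor (L.upTo v L.∷ʳ v))  ≡⟨ prodP-map factor (L.upTo v L.∷ʳ v) ⟩
    ΠP.Σ (L.upTo v L.∷ʳ v) factor        ≈⟨ ΠP.Σ-++ (L.upTo v) (v ∷ []) factor ⟩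
    ΠP.Σ (L.upTo v) factor *P (factor v *P 1P)
                                         ≈⟨ *P-cong (≡⇒≋ (≡.sym (prodP-map factor (L.upTo v)))) (*P-identityʳ (factor v)) ⟩
    θfall y v *P factor v                ∎
    where
    open import Relation.Binary.Reasoning.Setoid (≋-setoid _)
    factor = λ j → y -P θ^ (p ℕ.^ j)

  θfall-step : ∀ (y : Poly d) v → θfall y v *P y ≋ θfall y (suc v) +P (θfall y v *P θ^ (p ℕ.^ v))
  θfall-step y v = begin
    θfall y v *P y                                           ≈⟨ *P-congʳ (θfall y v) (-P-+P-cancel y θᵛ) ⟨
    θfall y v *P ((y -P θᵛ) +P θᵛ)                           ≈⟨ *P-distribˡ (θfall y v) (y -P θᵛ) θᵛ ⟩
    (θfall y v *P (y -P θᵛ)) +P (θfall y v *P θᵛ)            ≈⟨ +P-cong (θfall-suc y v) ≋.refl ⟨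
    θfall y (suc v) +P (θfall y v *P θᵛ)                     ∎
    where
    open import Relation.Binary.Reasoning.Setoid (≋-setoid _)
    θᵛ = θ^ (p ℕ.^ v)

  expansion : ∀ {d n} (Y : Fin n → Poly d) ν →
              Pθ Y ν *P prodP (map Y (L.allFin n))
              ≋ sumP (map (λ I → Pθ Y (ν ⁺ I) *P θcompl′ ν I) (allSubsets n))
  expansion {n = zero} Y V.[] = ≡⇒≋ (≡.sym (LP.++-identityʳ _))
  expansion {d} {suc n} Y (v V.∷ ν) = begin
    Pθ Y (v V.∷ ν) *P prodP (map Y (L.allFin (suc n)))
      ≡⟨ ≡.cong₂ _*P_ (Pθ-∷ Y v ν) (prodP-allFin-suc Y) ⟩
    (θfall y v *P Pθ Y′ ν) *P (y *P ∏Y′)     ≈⟨ *P-interchange (θfall y v) (Pθ Y′ ν) y ∏Y′ ⟩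
    (θfall y v *P y) *P (Pθ Y′ ν *P ∏Y′)     ≈⟨ *P-congʳ (θfall y v *P y) (expansion Y′ ν) ⟩
    (θfall y v *P y) *P R                    ≈⟨ *P-congˡ R (θfall-step y v) ⟩
    (θfall y (suc v) +P (θfall y v *P θᵛ)) *P R
                                             ≈⟨ *P-distribʳ (θfall y (suc v)) (θfall y v *P θᵛ) R ⟩
    (θfall y (suc v) *P R) +P ((θfall y v *P θᵛ) *P R)
                                             ≈⟨ +P-cong (split (θfall y (suc v))) (split (θfall y v *P θᵛ)) ⟩
    ΣP.Σ S (λ I → θfall y (suc v) *P H I) +P ΣP.Σ S (λ I → (θfall y v *P θᵛ) *P H I)
                                             ≈⟨ +P-cong (ΣP.Σ-cong S (≋.sym ∘ G-true)) (ΣP.Σ-cong S (≋.sym ∘ G-false)) ⟩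
    ΣP.Σ S (G ∘ (true V.∷_)) +P ΣP.Σ S (G ∘ (false V.∷_))
                                             ≡⟨ ≡.cong₂ _+P_ (ΣP.Σ-map (true V.∷_) S G) (ΣP.Σ-map (false V.∷_) S G) ⟨
    ΣP.Σ (map (true V.∷_) S) G +P ΣP.Σ (map (false V.∷_) S) G
                                             ≈⟨ ΣP.Σ-++ (map (true V.∷_) S) (map (false V.∷_) S) G ⟨
    ΣP.Σ (allSubsets (suc n)) G              ≡⟨ sumP-map G (allSubsets (suc n)) ⟨
    sumP (map G (allSubsets (suc n)))        ∎
    where
    open import Relation.Binary.Reasoning.Setoid (≋-setoid _)
    y   = Y Fin.zero
    Y′  = Y ∘ Fin.suc
    ∏Y′ = prodP (map Y′ (L.allFin n))
    θᵛ  = θ^ {d} (p ℕ.^ v)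
    S   = allSubsets n
    H : Vec Bool n → Poly d
    H I = Pθ Y′ (ν ⁺ I) *P θcompl′ ν I
    R   = sumP (map H S)
    G : Vec Bool (suc n) → Poly d
    G J = Pθ Y ((v V.∷ ν) ⁺ J) *P θcompl′ (v V.∷ ν) J
    split : ∀ A → A *P R ≋ ΣP.Σ S (λ I → A *P H I)
    split A = ≋.trans (*P-congʳ A (≡⇒≋ (sumP-map H S))) (*P-ΣP A S H)
    G-true : ∀ I → G (true V.∷ I) ≋ θfall y (suc v) *P H I
    G-true I = begin
      G (true V.∷ I)
        ≡⟨ ≡.cong₂ _*P_ (Pθ-∷ Y (suc v) (ν ⁺ I)) (θcompl′-∷ v ν true I) ⟩
      (θfall y (suc v) *P Pθ Y′ (ν ⁺ I)) *P (1P *P θcompl′ ν I)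
        ≈⟨ *P-congʳ (θfall y (suc v) *P Pθ Y′ (ν ⁺ I)) (*P-identityˡ (θcompl′ ν I)) ⟩
      (θfall y (suc v) *P Pθ Y′ (ν ⁺ I)) *P θcompl′ ν I
        ≈⟨ *P-assoc (θfall y (suc v)) (Pθ Y′ (ν ⁺ I)) (θcompl′ ν I) ⟩
      θfall y (suc v) *P H I ∎
    G-false : ∀ I → G (false V.∷ I) ≋ (θfall y v *P θᵛ) *P H I
    G-false I = ≋.trans (≡⇒≋ (≡.cong₂ _*P_ (Pθ-∷ Y v (ν ⁺ I)) (θcompl′-∷ v ν false I)))
                        (*P-interchange (θfall y v) (Pθ Y′ (ν ⁺ I)) θᵛ (θcompl′ ν I))

act-θfall : ∀ p (σ : Vec (Fin d) d) y v → act σ (θfall p y v) ≡ θfall p (act σ y) v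
act-θfall p σ y v = ≡.trans (act-prodP-map σ _ (L.upTo v)) (≡.cong prodP (LP.map-cong factor (L.upTo v)))
  where
  factor : ∀ j → act σ (y -P θ^ (p ℕ.^ j)) ≡ act σ y -P θ^ (p ℕ.^ j)
  factor j = ≡.trans (act-+P σ y (-P θ^ (p ℕ.^ j)))
                     (≡.cong (act σ y +P_) (≡.trans (act--P σ (θ^ (p ℕ.^ j))) (≡.cong -P_ (act-θ^ σ (p ℕ.^ j)))))

act-Pθ : ∀ p (σ : Vec (Fin d) d) (Y : Fin n → Poly d) ν → act σ (Pθ p Y ν) ≡ Pθ p (act σ ∘ Y) ν
act-Pθ {n = n} p σ Y ν = ≡.trans (act-prodP-map σ _ (L.allFin n))
                                 (≡.cong prodP (LP.map-cong (λ i → act-θfall p σ (Y i) (V.lookup ν i)) (L.allFin n)))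

Pθ-zero : ∀ p (Y : Fin n → Poly d) → Pθ p Y (replicate n 0) ≋ 1P
Pθ-zero {n = n} p Y = ≋.trans
  (≡⇒≋ (≡.trans (≡.cong prodP (LP.map-cong (λ i → ≡.cong (θfall p (Y i)) (VP.lookup-replicate i 0)) (L.allFin n)))
                (prodP-map (λ _ → 1P) (L.allFin n))))
  (ΠP.Σ-ε (L.allFin n))

_∈?_ : ∀ {m k} (a : Fin m) (w : Vec (Fin m) k) → Dec (a ∈ w)
a ∈? w = Any.any? (a Fin.≟_) w

∷-injective⁻ : ∀ {m k} {a : Fin m} {w : Vec (Fin m) k} →
               Injective _≡_ _≡_ (V.lookup (a V.∷ w)) → a ∉ w × Injective _≡_ _≡_ (V.lookup w)
∷-injective⁻ {w = w} inj = (λ a∈w → case inj {Fin.zero} {Fin.suc (Any.index a∈w)} (lookup-index a∈w) of λ ())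
                         , (λ e → FinP.suc-injective (inj e))

∷-injective : ∀ {m k} {a : Fin m} {w : Vec (Fin m) k} →
              a ∉ w → Injective _≡_ _≡_ (V.lookup w) → Injective _≡_ _≡_ (V.lookup (a V.∷ w))
∷-injective         a∉w inj {Fin.zero}  {Fin.zero}  e = ≡.refl
∷-injective {w = w} a∉w inj {Fin.zero}  {Fin.suc j} e = ⊥-elim (a∉w (≡.subst (_∈ w) (≡.sym e) (∈-lookup j w)))
∷-injective {w = w} a∉w inj {Fin.suc i} {Fin.zero}  e = ⊥-elim (a∉w (≡.subst (_∈ w) e (∈-lookup i w)))
∷-injective         a∉w inj {Fin.suc i} {Fin.suc j} e = ≡.cong Fin.suc (inj e)

lookup-injective? : ∀ {m k} (w : Vec (Fin m) k) → Dec (Injective _≡_ _≡_ (V.lookup w))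
lookup-injective? V.[]       = yes λ { {()} }
lookup-injective? (a V.∷ w) = map′ (uncurry ∷-injective) ∷-injective⁻ (¬? (a ∈? w) ×-dec lookup-injective? w)

χ-∨-disjoint : ∀ {m k} (a b : Fin m) {w : Vec (Fin m) k} → b ∉ w →
               χ (does (a Fin.≟ b) ∨ does (a ∈? w)) ≡ χ (does (a Fin.≟ b)) ℕ.+ χ (does (a ∈? w))
χ-∨-disjoint a b {w} b∉w with a Fin.≟ b
... | yes ≡.refl rewrite dec-false (a ∈? w) b∉w = ≡.refl
... | no  _      = ≡.refl

member-count : ∀ {m k} (w : Vec (Fin m) k) → Injective _≡_ _≡_ (V.lookup w) →
               ℕΣ.Σ (L.allFin m) (λ a → χ (does (a ∈? w))) ≡ k
member-count {m} V.[]       inj = ℕΣ.Σ-ε (L.allFin m)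
member-count {m} (b V.∷ w) inj = begin
  ℕΣ.Σ (L.allFin m) (λ a → χ (does (a Fin.≟ b) ∨ does (a ∈? w)))
    ≡⟨ ℕΣ.Σ-cong (L.allFin m) (λ a → χ-∨-disjoint a b b∉w) ⟩
  ℕΣ.Σ (L.allFin m) (λ a → χ (does (a Fin.≟ b)) ℕ.+ χ (does (a ∈? w)))
    ≡⟨ ℕΣ.Σ-∙ (L.allFin m) (λ a → χ (does (a Fin.≟ b))) (λ a → χ (does (a ∈? w))) ⟩
  ℕΣ.Σ (L.allFin m) (λ a → χ (does (a Fin.≟ b))) ℕ.+ ℕΣ.Σ (L.allFin m) (λ a → χ (does (a ∈? w)))
    ≡⟨ ≡.cong₂ ℕ._+_ (Σ-allFin-δ b) (member-count w inj-w) ⟩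
  suc _ ∎
  where
  open ≡.≡-Reasoning
  b∉w   = proj₁ (∷-injective⁻ inj)
  inj-w = proj₂ (∷-injective⁻ inj)

nonmember-count : ∀ {m k} (w : Vec (Fin m) k) → Injective _≡_ _≡_ (V.lookup w) →
                  ℕΣ.Σ (L.allFin m) (λ a → χ (not (does (a ∈? w)))) ≡ m ℕ.∸ k
nonmember-count {m} {k} w inj = begin
  nonmembers                                                 ≡⟨ ℕP.m+n∸n≡m nonmembers k ⟨
  nonmembers ℕ.+ k ℕ.∸ k                                     ≡⟨ ≡.cong (λ x → nonmembers ℕ.+ x ℕ.∸ k) (member-count w inj) ⟨
  nonmembers ℕ.+ ℕΣ.Σ (L.allFin m) (λ a → χ (does (a ∈? w))) ℕ.∸ k
                                                             ≡⟨ ≡.cong (ℕ._∸ k) all ⟩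
  m ℕ.∸ k                                                    ∎
  where
  open ≡.≡-Reasoning
  nonmembers = ℕΣ.Σ (L.allFin m) (λ a → χ (not (does (a ∈? w))))
  all : nonmembers ℕ.+ ℕΣ.Σ (L.allFin m) (λ a → χ (does (a ∈? w))) ≡ m
  all = ≡.trans (≡.sym (ℕΣ.Σ-∙ (L.allFin m) _ _))
                (≡.trans (ℕΣ.Σ-cong (L.allFin m) (λ a → χ-not (does (a ∈? w)))) (Σ-allFin-1 m))

injection-count : ℕ → ℕ → ℕ
injection-count k m = ℕΣ.Σ (allVecs k m) (λ w → χ (does (lookup-injective? w)))

injection-count-suc : ∀ k m → injection-count (suc k) m ≡ (m ℕ.∸ k) ℕ.* injection-count k m
injection-count-suc k m = begin
  ℕΣ.Σ (concatMap (λ a → map (a V.∷_) (allVecs k m)) (L.allFin m)) count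
    ≡⟨ ℕΣ.Σ-concatMap (λ a → map (a V.∷_) (allVecs k m)) (L.allFin m) count ⟩
  ℕΣ.Σ (L.allFin m) (λ a → ℕΣ.Σ (map (a V.∷_) (allVecs k m)) count)
    ≡⟨ ℕΣ.Σ-cong (L.allFin m) (λ a → ℕΣ.Σ-map (a V.∷_) (allVecs k m) count) ⟩
  ℕΣ.Σ (L.allFin m) (λ a → ℕΣ.Σ (allVecs k m) (λ w → count (a V.∷ w)))
    ≡⟨ ℕΣ.Σ-swap (L.allFin m) (allVecs k m) (λ a w → count (a V.∷ w)) ⟩
  ℕΣ.Σ (allVecs k m) (λ w → ℕΣ.Σ (L.allFin m) (λ a → count (a V.∷ w)))
    ≡⟨ ℕΣ.Σ-cong (allVecs k m) extensions ⟩
  ℕΣ.Σ (allVecs k m) (λ w → (m ℕ.∸ k) ℕ.* count w)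
    ≡⟨ Σ-homo ℕP.+-0-commutativeMonoid ℕP.+-0-commutativeMonoid ((m ℕ.∸ k) ℕ.*_)
              (ℕP.*-zeroʳ (m ℕ.∸ k)) (ℕP.*-distribˡ-+ (m ℕ.∸ k)) (allVecs k m) count ⟨
  (m ℕ.∸ k) ℕ.* injection-count k m ∎
  where
  open ≡.≡-Reasoning
  count : ∀ {k} → Vec (Fin m) k → ℕ
  count w = χ (does (lookup-injective? w))
  extensions : ∀ w → ℕΣ.Σ (L.allFin m) (λ a → count (a V.∷ w)) ≡ (m ℕ.∸ k) ℕ.* count w
  extensions w with lookup-injective? w
  ... | yes inj = ≡.trans (ℕΣ.Σ-cong (L.allFin m) (λ a → ≡.cong χ (BP.∧-identityʳ _)))
                          (≡.trans (nonmember-count w inj) (≡.sym (ℕP.*-identityʳ (m ℕ.∸ k))))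
  ... | no _    = ≡.trans (ℕΣ.Σ-cong (L.allFin m) (λ a → ≡.cong χ (BP.∧-zeroʳ _)))
                          (≡.trans (ℕΣ.Σ-ε (L.allFin m)) (≡.sym (ℕP.*-zeroʳ (m ℕ.∸ k))))

injection-count≡fallingFactorial : ∀ k m → injection-count k m ≡ fallingFactorial m k
injection-count≡fallingFactorial zero    m = ≡.refl
injection-count≡fallingFactorial (suc k) m =
  ≡.trans (injection-count-suc k m) (≡.cong ((m ℕ.∸ k) ℕ.*_) (injection-count≡fallingFactorial k m))

allB-tabulate : ∀ {A : Set} (f : A → Bool) (g : Fin n → A) →
                allB f (L.tabulate g) ≡ true ⇔ (∀ i → f (g i) ≡ true)
allB-tabulate {n} f g = mk⇔ (to n g) (from n g)
  where
  to : ∀ n (g : Fin n → _) → allB f (L.tabulate g) ≡ true → ∀ i → f (g i) ≡ true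
  to (suc n) g all i with f (g Fin.zero) in e | i
  ... | true | Fin.zero  = e
  ... | true | Fin.suc i = to n (g ∘ Fin.suc) all i
  from : ∀ n (g : Fin n → _) → (∀ i → f (g i) ≡ true) → allB f (L.tabulate g) ≡ true
  from zero    g all = ≡.refl
  from (suc n) g all rewrite all Fin.zero = from n (g ∘ Fin.suc) (all ∘ Fin.suc)

injective?⇔ : (σ : Vec (Fin n) n) → injective? σ ≡ true ⇔ Injective _≡_ _≡_ (V.lookup σ)
injective?⇔ {n} σ = mk⇔
  (λ e {i} {j} → Equivalence.to (pair i j) (Equivalence.to (allB-tabulate _ id)
                   (Equivalence.to (allB-tabulate _ id) e i) j))
  (λ inj → Equivalence.from (allB-tabulate _ id) λ i →
           Equivalence.from (allB-tabulate _ id) λ j → Equivalence.from (pair i j) inj)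
  where
  pair : ∀ i j → (isYes (i Fin.≟ j) ∨ not (isYes (V.lookup σ i Fin.≟ V.lookup σ j))) ≡ true
                 ⇔ (V.lookup σ i ≡ V.lookup σ j → i ≡ j)
  pair i j with i Fin.≟ j | V.lookup σ i Fin.≟ V.lookup σ j
  ... | yes i≡j | _         = mk⇔ (λ _ _ → i≡j) (λ _ → ≡.refl)
  ... | no  _   | no σi≢σj  = mk⇔ (λ _ e → ⊥-elim (σi≢σj e)) (λ _ → ≡.refl)
  ... | no  i≢j | yes σi≡σj = mk⇔ (λ ()) (λ inj → ⊥-elim (i≢j (inj σi≡σj)))

∈-Sym⇒injective : ∀ {σ : Vec (Fin n) n} → σ ∈ₗ Sym n → Injective _≡_ _≡_ (V.lookup σ)
∈-Sym⇒injective {n} {σ} σ∈Sym = Equivalence.to (injective?⇔ σ)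
  (proj₂ (∈-filter⁻ (λ σ → injective? σ BP.≟ true) {xs = allVecs n n} σ∈Sym))

length-filter : ∀ {A : Set} {P : A → Set} (P? : ∀ x → Dec (P x)) xs →
                L.length (L.filter P? xs) ≡ ℕΣ.Σ xs (χ ∘ does ∘ P?)
length-filter P? []       = ≡.refl
length-filter P? (x ∷ xs) with does (P? x)
... | true  = ≡.cong suc (length-filter P? xs)
... | false = length-filter P? xs

length-Sym : ∀ n → L.length (Sym n) ≡ n ℕ.!
length-Sym n = begin
  L.length (Sym n)                                                 ≡⟨ length-filter _ (allVecs n n) ⟩
  ℕΣ.Σ (allVecs n n) (λ σ → χ (does (injective? σ BP.≟ true)))   ≡⟨ ℕΣ.Σ-cong (allVecs n n) (λ σ → ≡.cong χ
                                                                        (does-⇔ (injective?⇔ σ) (injective? σ BP.≟ true)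
                                                                                (lookup-injective? σ))) ⟩
  injection-count n n                                              ≡⟨ injection-count≡fallingFactorial n n ⟩
  fallingFactorial n n                                                      ≡⟨ nP′n≡n! n ⟩
  n ℕ.!                                                            ∎
  where open ≡.≡-Reasoning

injective⇒surjective : ∀ {σ : Vec (Fin n) n} → Injective _≡_ _≡_ (V.lookup σ) → ∀ j → j ∈ σ
injective⇒surjective {n} {σ} inj j with j ∈? σ | Σ-allFin-≡0 _ (≡.trans (nonmember-count σ inj) (ℕP.n∸n≡0 n)) j
... | yes j∈σ | _  = j∈σ
... | no  _   | ()

hit-count : ∀ {σ : Vec (Fin n) n} → Injective _≡_ _≡_ (V.lookup σ) →
            ∀ j → ℕΣ.Σ (L.allFin n) (λ i → χ (does (V.lookup σ i Fin.≟ j))) ≡ 1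
hit-count {n} {σ} inj j =
  ≡.trans (ℕΣ.Σ-cong (L.allFin n) (λ i → ≡.cong χ (does-⇔ (hit⇔ i) (V.lookup σ i Fin.≟ j) (i Fin.≟ idx))))
          (Σ-allFin-δ idx)
  where
  j∈σ = injective⇒surjective {σ = σ} inj j
  idx = Any.index j∈σ
  hit⇔ : ∀ i → (V.lookup σ i ≡ j) ⇔ (i ≡ idx)
  hit⇔ i = mk⇔ (λ e → inj (≡.trans e (lookup-index j∈σ))) (λ { ≡.refl → ≡.sym (lookup-index j∈σ) })

ones : ∀ n → Vec ℕ n
ones n = V.tabulate (λ _ → 1)

prodX≡ : ∀ n → prodX n ≡ (+ 1 , ones n , 0) ∷ []
prodX≡ n = ≡.trans (product (L.allFin n))
                   (≡.cong (λ e → (+ 1 , e , 0) ∷ []) (VP.tabulate-cong λ j →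
                     ≡.trans (ℕΣ.Σ-cong (L.allFin n) (λ i → ≡.cong χ (isYes≗does (i Fin.≟ j)))) (Σ-allFin-δ j)))
  where
  product : (is : List (Fin n)) →
            prodP (map X is) ≡ (+ 1 , V.tabulate (λ j → ℕΣ.Σ is (λ i → χ (isYes (i Fin.≟ j)))) , 0) ∷ []
  product []       = ≡.cong (λ e → (+ 1 , e , 0) ∷ []) (≡.sym (tabulate-const 0))
  product (i ∷ is) = ≡.trans (≡.cong (X i *P_) (product is))
                             (≡.cong (λ e → (+ 1 , e , 0) ∷ []) (zipWith-tabulate ℕ._+_ _ _))

act-prodX : ∀ {σ : Vec (Fin n) n} → Injective _≡_ _≡_ (V.lookup σ) → act σ (prodX n) ≡ prodX n
act-prodX {n} {σ} inj = begin
  act σ (prodX n)                           ≡⟨ ≡.cong (act σ) (prodX≡ n) ⟩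
  (+ 1 , actMono σ (ones n , 0)) ∷ []       ≡⟨ ≡.cong (λ e → (+ 1 , e , 0) ∷ []) (VP.tabulate-cong exponent) ⟩
  (+ 1 , ones n , 0) ∷ []                   ≡⟨ prodX≡ n ⟨
  prodX n                                   ∎
  where
  open ≡.≡-Reasoning
  select : Fin n → Fin n → ℕ
  select j i = if isYes (V.lookup σ i Fin.≟ j) then V.lookup (ones n) i else 0
  select≡χ : ∀ j i → select j i ≡ χ (does (V.lookup σ i Fin.≟ j))
  select≡χ j i with V.lookup σ i Fin.≟ j
  ... | yes _ = VP.lookup∘tabulate (λ _ → 1) i
  ... | no  _ = ≡.refl
  exponent : ∀ j → V.sum (V.tabulate (select j)) ≡ 1
  exponent j = ≡.trans (sum-tabulate (select j))
                       (≡.trans (ℕΣ.Σ-cong (L.allFin n) (select≡χ j)) (hit-count {σ = σ} inj j))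

-- Fermat's little theorem


binomialSum : ℕ → ℕ → ℕ → ℕ
binomialSum a n zero    = 1
binomialSum a n (suc m) = binomialSum a n m ℕ.+ (n C suc m) ℕ.* a ℕ.^ suc m

binomialSum-suc : ∀ a n m → binomialSum a (suc n) (suc m) ≡ a ℕ.* binomialSum a n m ℕ.+ binomialSum a n (suc m)
binomialSum-suc a n zero rewrite nC1≡n (suc n) | nC1≡n n =
  solve 2 (λ a n → con 1 :+ (con 1 :+ n) :* (a :* con 1) := a :* con 1 :+ (con 1 :+ n :* (a :* con 1))) ≡.refl a n
binomialSum-suc a n (suc m)
  rewrite binomialSum-suc a n m | ≡.sym (nCk+nC[k+1]≡[n+1]C[k+1] n (suc m)) =
  solve 5 (λ a t b₁ b₂ e → a :* t :+ (t :+ b₁ :* e) :+ (b₁ :+ b₂) :* (a :* e)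
                         := a :* (t :+ b₁ :* e) :+ (t :+ b₁ :* e :+ b₂ :* (a :* e)))
          ≡.refl a (binomialSum a n m) (n C suc m) (n C suc (suc m)) (a ℕ.^ suc m)

binomial : ∀ a n → suc a ℕ.^ n ≡ binomialSum a n n
binomial a zero    = ≡.refl
binomial a (suc n) = begin
  suc a ℕ.* suc a ℕ.^ n                                     ≡⟨ ≡.cong (suc a ℕ.*_) (binomial a n) ⟩
  suc a ℕ.* binomialSum a n n                               ≡⟨⟩
  binomialSum a n n ℕ.+ a ℕ.* binomialSum a n n             ≡⟨ ℕP.+-comm (binomialSum a n n) _ ⟩
  a ℕ.* binomialSum a n n ℕ.+ binomialSum a n n             ≡⟨ ≡.cong (a ℕ.* binomialSum a n n ℕ.+_) top-vanishes ⟨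
  a ℕ.* binomialSum a n n ℕ.+ binomialSum a n (suc n)       ≡⟨ binomialSum-suc a n n ⟨
  binomialSum a (suc n) (suc n)                             ∎
  where
  open ≡.≡-Reasoning
  top-vanishes : binomialSum a n (suc n) ≡ binomialSum a n n
  top-vanishes rewrite k>n⇒nCk≡0 (ℕP.n<1+n n) = ℕP.+-identityʳ _

module _ {n : ℕ} (p-prime : Prime (suc n)) where
  private
    p = suc n

  p∤! : ∀ {m} → m < p → ¬ p ∣ m ℕ.!
  p∤! {zero}  _   p∣1 = ℕP.<⇒≱ (ℕ.nonTrivial⇒n>1 p {{prime⇒nonTrivial p-prime}}) (∣⇒≤ p∣1)
  p∤! {suc m} m<p p∣m! with euclidsLemma (suc m) (m ℕ.!) p-prime p∣m!
  ... | inj₁ p∣1+m = ℕP.<⇒≱ m<p (∣⇒≤ p∣1+m)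
  ... | inj₂ p∣m!  = p∤! (ℕP.<-trans (ℕP.n<1+n m) m<p) p∣m!

  p∣pCk : ∀ {k} → 0 < k → k < p → p ∣ p C k
  p∣pCk {suc k} _ k<p with euclidsLemma (p C suc k) D p-prime (divides (n ℕ.!) (≡.trans pCk*D≡p! (ℕP.*-comm p (n ℕ.!))))
    where
    D = suc k ℕ.! ℕ.* (p ℕ.∸ suc k) ℕ.!
    instance _ = ℕP._!*_!≢0 (suc k) (p ℕ.∸ suc k)
    pCk*D≡p! : (p C suc k) ℕ.* D ≡ p ℕ.!
    pCk*D≡p! = ≡.trans (≡.cong (ℕ._* D) (nCk≡n!/k![n-k]! (ℕP.<⇒≤ k<p))) (m/n*n≡m (k![n∸k]!∣n! (ℕP.<⇒≤ k<p)))
  ... | inj₁ p∣C = p∣C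
  ... | inj₂ p∣D with euclidsLemma (suc k ℕ.!) ((p ℕ.∸ suc k) ℕ.!) p-prime p∣D
  ...   | inj₁ p∣k!   = ⊥-elim (p∤! k<p p∣k!)
  ...   | inj₂ p∣p-k! = ⊥-elim (p∤! (ℕ.s≤s (ℕP.m∸n≤m n k)) p∣p-k!)

  binomialSum-low : ∀ a m → m < p → ∃ λ c → binomialSum a p m ≡ 1 ℕ.+ c ℕ.* p
  binomialSum-low a zero    _   = 0 , ≡.refl
  binomialSum-low a (suc m) m<p with binomialSum-low a m (ℕP.<-trans (ℕP.n<1+n m) m<p)
                                   | p∣pCk (ℕ.s≤s ℕ.z≤n) m<p
  ... | c , eq | divides q pCm≡q*p = c ℕ.+ q ℕ.* a ℕ.^ suc m , (begin
    binomialSum a p m ℕ.+ (p C suc m) ℕ.* a ℕ.^ suc m   ≡⟨ ≡.cong₂ (λ x y → x ℕ.+ y ℕ.* a ℕ.^ suc m) eq pCm≡q*p ⟩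
    1 ℕ.+ c ℕ.* p ℕ.+ q ℕ.* p ℕ.* a ℕ.^ suc m         ≡⟨ solve 4 (λ c p q e → con 1 :+ c :* p :+ q :* p :* e
                                                                          := con 1 :+ (c :+ q :* e) :* p)
                                                                ≡.refl c p q (a ℕ.^ suc m) ⟩
    1 ℕ.+ (c ℕ.+ q ℕ.* a ℕ.^ suc m) ℕ.* p              ∎)
    where open ≡.≡-Reasoning

  fermat : ∀ a → ∃ λ d → a ℕ.^ p ≡ a ℕ.+ d ℕ.* p
  fermat zero    = 0 , ≡.refl
  fermat (suc a) with fermat a | binomialSum-low a n (ℕP.n<1+n n)
  ... | d , aᵖ≡a+dp | c , low≡1+cp = c ℕ.+ d , (begin
    suc a ℕ.^ p                                      ≡⟨ binomial a p ⟩
    binomialSum a p n ℕ.+ (p C p) ℕ.* a ℕ.^ p        ≡⟨ ≡.cong₂ (λ x y → x ℕ.+ y ℕ.* a ℕ.^ p) low≡1+cp (nCn≡1 p) ⟩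
    1 ℕ.+ c ℕ.* p ℕ.+ 1 ℕ.* a ℕ.^ p                  ≡⟨ ≡.cong (λ x → 1 ℕ.+ c ℕ.* p ℕ.+ 1 ℕ.* x) aᵖ≡a+dp ⟩
    1 ℕ.+ c ℕ.* p ℕ.+ 1 ℕ.* (a ℕ.+ d ℕ.* p)          ≡⟨ solve 4 (λ a c d p → con 1 :+ c :* p :+ con 1 :* (a :+ d :* p)
                                                                       := con 1 :+ a :+ (c :+ d) :* p)
                                                             ≡.refl a c d p ⟩
    suc a ℕ.+ (c ℕ.+ d) ℕ.* p                        ∎)
    where open ≡.≡-Reasoning

  fermat-coprime : ∀ a .{{_ : ℕ.NonZero a}} → ¬ p ∣ a → p ∣ a ℕ.^ n ℕ.∸ 1
  fermat-coprime a p∤a with fermat a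
  ... | d , aᵖ≡a+dp with euclidsLemma a (a ℕ.^ n ℕ.∸ 1) p-prime (divides d a[aⁿ-1]≡dp)
    where
    a[aⁿ-1]≡dp : a ℕ.* (a ℕ.^ n ℕ.∸ 1) ≡ d ℕ.* p
    a[aⁿ-1]≡dp = begin
      a ℕ.* (a ℕ.^ n ℕ.∸ 1)      ≡⟨ ℕP.*-distribˡ-∸ a (a ℕ.^ n) 1 ⟩
      a ℕ.^ p ℕ.∸ a ℕ.* 1        ≡⟨ ≡.cong₂ ℕ._∸_ aᵖ≡a+dp (ℕP.*-identityʳ a) ⟩
      a ℕ.+ d ℕ.* p ℕ.∸ a        ≡⟨ ℕP.m+n∸m≡n a (d ℕ.* p) ⟩
      d ℕ.* p                    ∎
      where open ≡.≡-Reasoning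
  ... | inj₁ p∣a      = ⊥-elim (p∤a p∣a)
  ... | inj₂ p∣aⁿ-1   = p∣aⁿ-1

invFact-inverse : ∀ {r ℓ} → Prime (2 ℕ.+ r) → ℓ < 2 ℕ.+ r →
                  (+ (2 ℕ.+ r)) ℤD.∣ (invFact (2 ℕ.+ r) ℓ ℤ.* + (ℓ ℕ.!) ℤ.- + 1)
invFact-inverse {r} {ℓ} p-prime ℓ<p =
  ≡.subst (λ z → (+ (2 ℕ.+ r)) ℤD.∣ z) (≡.sym k*ℓ!-1≡)
          (fermat-coprime p-prime (ℓ ℕ.!) {{ℓ ℕP.!≢0}} (p∤! p-prime ℓ<p))
  where
  open ≡.≡-Reasoning
  k*ℓ!-1≡ : invFact (2 ℕ.+ r) ℓ ℤ.* + (ℓ ℕ.!) ℤ.- + 1 ≡ + ((ℓ ℕ.!) ℕ.^ suc r ℕ.∸ 1)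
  k*ℓ!-1≡ = begin
    + ((ℓ ℕ.!) ℕ.^ r) ℤ.* + (ℓ ℕ.!) ℤ.- + 1    ≡⟨ ≡.cong (ℤ._- + 1) (ℤP.pos-* ((ℓ ℕ.!) ℕ.^ r) (ℓ ℕ.!)) ⟨
    + ((ℓ ℕ.!) ℕ.^ r ℕ.* ℓ ℕ.!) ℤ.- + 1        ≡⟨ ≡.cong (λ z → + z ℤ.- + 1) (ℕP.*-comm ((ℓ ℕ.!) ℕ.^ r) (ℓ ℕ.!)) ⟩
    + ((ℓ ℕ.!) ℕ.^ suc r) ℤ.- + 1             ≡⟨ ℤP.m-n≡m⊖n ((ℓ ℕ.!) ℕ.^ suc r) 1 ⟩
    (ℓ ℕ.!) ℕ.^ suc r ℤ.⊖ 1                   ≡⟨ ℤP.⊖-≥ (ℕP.m^n>0 (ℓ ℕ.!) {{ℓ ℕP.!≢0}} (suc r)) ⟩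
    + ((ℓ ℕ.!) ℕ.^ suc r ℕ.∸ 1)               ∎

-- Averaging over the symmetric group

permuted-expansion : ∀ p {ℓ} {σ : Vec (Fin ℓ) ℓ} → σ ∈ₗ Sym ℓ → ∀ ν →
  act σ (Pν p ν) *P prodX ℓ ≋ sumP (map (λ I → act σ (Pν p (ν ⁺ I)) *P θcompl p ν I) (allSubsets ℓ))
permuted-expansion p {ℓ} {σ} σ∈Sym ν = begin
  act σ (Pν p ν) *P prodX ℓ                                   ≡⟨ ≡.cong₂ _*P_ (act-Pθ p σ X ν) invariance ⟩
  Pθ p (act σ ∘ X) ν *P prodP (map (act σ ∘ X) (L.allFin ℓ))  ≈⟨ expansion p (act σ ∘ X) ν ⟩
  sumP (map (λ I → Pθ p (act σ ∘ X) (ν ⁺ I) *P θcompl p ν I) (allSubsets ℓ))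
                                                              ≡⟨ ≡.cong sumP (LP.map-cong (λ I →
                                                                   ≡.cong (_*P θcompl p ν I) (≡.sym (act-Pθ p σ X (ν ⁺ I))))
                                                                   (allSubsets ℓ)) ⟩
  sumP (map (λ I → act σ (Pν p (ν ⁺ I)) *P θcompl p ν I) (allSubsets ℓ)) ∎
  where
  open import Relation.Binary.Reasoning.Setoid (≋-setoid _)
  invariance : prodX ℓ ≡ prodP (map (act σ ∘ X) (L.allFin ℓ))
  invariance = ≡.trans (≡.sym (act-prodX {σ = σ} (∈-Sym⇒injective σ∈Sym))) (act-prodP-map σ X (L.allFin ℓ))

b-expansion : ∀ p {ℓ} (ν : Vec ℕ ℓ) →
  b p ν *P prodX ℓ ≋ sumP (map (λ I → b p (ν ⁺ I) *P θcompl p ν I) (allSubsets ℓ))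
b-expansion p {ℓ} ν = begin
  scale k (sumP (map (λ σ → act σ (Pν p ν)) S)) *P prodX ℓ
    ≈⟨ scale-*P k (sumP (map (λ σ → act σ (Pν p ν)) S)) (prodX ℓ) ⟩
  scale k (sumP (map (λ σ → act σ (Pν p ν)) S) *P prodX ℓ)
    ≈⟨ scale-cong k (≋.trans (*P-congˡ (prodX ℓ) (≡⇒≋ (sumP-map _ S))) (ΣP-*P (prodX ℓ) S _)) ⟩
  scale k (ΣP.Σ S (λ σ → act σ (Pν p ν) *P prodX ℓ))
    ≈⟨ scale-cong k (ΣP.Σ-cong-∈ S (λ σ∈S → ≋.trans (permuted-expansion p σ∈S ν) (≡⇒≋ (sumP-map _ Subs)))) ⟩
  scale k (ΣP.Σ S (λ σ → ΣP.Σ Subs (λ I → term σ I)))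
    ≈⟨ scale-cong k (ΣP.Σ-swap S Subs term) ⟩
  scale k (ΣP.Σ Subs (λ I → ΣP.Σ S (λ σ → term σ I)))
    ≈⟨ scale-ΣP k Subs _ ⟩
  ΣP.Σ Subs (λ I → scale k (ΣP.Σ S (λ σ → term σ I)))
    ≈⟨ ΣP.Σ-cong Subs (λ I → ≋.sym (average I)) ⟩
  ΣP.Σ Subs (λ I → b p (ν ⁺ I) *P θcompl p ν I)
    ≡⟨ sumP-map _ Subs ⟨
  sumP (map (λ I → b p (ν ⁺ I) *P θcompl p ν I) Subs) ∎
  where
  open import Relation.Binary.Reasoning.Setoid (≋-setoid _)
  k    = invFact p ℓ
  S    = Sym ℓ
  Subs = allSubsets ℓ
  term : Vec (Fin ℓ) ℓ → Vec Bool ℓ → Poly ℓ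
  term σ I = act σ (Pν p (ν ⁺ I)) *P θcompl p ν I
  average : ∀ I → b p (ν ⁺ I) *P θcompl p ν I ≋ scale k (ΣP.Σ S (λ σ → term σ I))
  average I = ≋.trans (scale-*P k (sumP (map (λ σ → act σ (Pν p (ν ⁺ I))) S)) (θcompl p ν I))
              (scale-cong k (≋.trans (*P-congˡ (θcompl p ν I) (≡⇒≋ (sumP-map (λ σ → act σ (Pν p (ν ⁺ I))) S)))
                                     (ΣP-*P (θcompl p ν I) S (λ σ → act σ (Pν p (ν ⁺ I))))))

b-zero : ∀ p ℓ → b p (replicate ℓ 0) ≋ scale (invFact p ℓ ℤ.* + (ℓ ℕ.!)) 1P
b-zero p ℓ = begin
  scale k (sumP (map (λ σ → act σ (Pν p zeros)) (Sym ℓ)))    ≈⟨ scale-cong k (≡⇒≋ (sumP-map _ (Sym ℓ))) ⟩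
  scale k (ΣP.Σ (Sym ℓ) (λ σ → act σ (Pν p zeros)))          ≈⟨ scale-cong k (ΣP.Σ-cong (Sym ℓ) (λ σ →
                                                                  ≋.trans (≡⇒≋ (act-Pθ p σ X zeros)) (Pθ-zero p (act σ ∘ X)))) ⟩
  scale k (ΣP.Σ (Sym ℓ) (λ _ → 1P))                          ≈⟨ scale-cong k (ΣP-const (Sym ℓ) 1P) ⟩
  scale k (scale (+ L.length (Sym ℓ)) 1P)                    ≡⟨ ≡.cong (λ n → scale k (scale (+ n) 1P)) (length-Sym ℓ) ⟩
  scale k (scale (+ (ℓ ℕ.!)) 1P)                             ≈⟨ scale-scale k (+ (ℓ ℕ.!)) 1P ⟩
  scale (k ℤ.* + (ℓ ℕ.!)) 1P                                 ∎
  where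
  open import Relation.Binary.Reasoning.Setoid (≋-setoid _)
  k     = invFact p ℓ
  zeros = replicate ℓ 0

≋⇒≈ : ∀ p {P Q : Poly d} → P ≋ Q → P ≈[ p ] Q
≋⇒≈ p {Q = Q} P≋Q m rewrite coeff-≡ P≋Q m | ℤP.+-inverseʳ (coeff Q m) = p ∣0

≋-≈-trans : ∀ {p} {P Q R : Poly d} → P ≋ Q → Q ≈[ p ] R → P ≈[ p ] R
≋-≈-trans P≋Q Q≈R m rewrite coeff-≡ P≋Q m = Q≈R m

scale-≈ : ∀ {p c} (P : Poly d) → (+ p) ℤD.∣ (c ℤ.- + 1) → scale c P ≈[ p ] P
scale-≈ {p = p} {c} P p∣c-1 m = ≡.subst (λ z → (+ p) ℤD.∣ z) (≡.sym c*x-x≡) (multiple p∣c-1)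
  where
  x = coeff P m
  c*x-x≡ : coeff (scale c P) m ℤ.- x ≡ (c ℤ.- + 1) ℤ.* x
  c*x-x≡ = ≡.trans (≡.cong (ℤ._- x) (coeff-scale c P m))
                   (≡.sym (≡.trans (ℤP.*-distribʳ-+ x c ℤ.-1ℤ) (≡.cong (λ z → c ℤ.* x ℤ.+ z) (ℤP.-1*i≡-i x))))
  multiple : (+ p) ℤD.∣ (c ℤ.- + 1) → (+ p) ℤD.∣ ((c ℤ.- + 1) ℤ.* x)
  multiple p∣ = ≡.subst (p ∣_) (≡.sym (ℤP.abs-* (c ℤ.- + 1) x)) (∣-trans p∣ (m∣m*n ℤ.∣ x ∣))

b-zero≈1P : ∀ {r ℓ} → Prime (2 ℕ.+ r) → ℓ < 2 ℕ.+ r → b (2 ℕ.+ r) (replicate ℓ 0) ≈[ 2 ℕ.+ r ] 1P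
b-zero≈1P {r} {ℓ} p-prime ℓ<p =
  ≋-≈-trans {Q = scale c 1P} {R = 1P} (b-zero (2 ℕ.+ r) ℓ) (scale-≈ {c = c} 1P (invFact-inverse p-prime ℓ<p))
  where c = invFact (2 ℕ.+ r) ℓ ℤ.* + (ℓ ℕ.!)

theorem3p3 : (p ℓ : ℕ) → Prime p → 1 ≤ ℓ → ℓ < p →
    (b p (replicate ℓ 0) ≈[ p ] 1P)
    × ((ν : Vec ℕ ℓ) →
       (b p ν *P prodX ℓ) ≈[ p ] sumP (map (λ I → b p (ν ⁺ I) *P θcompl p ν I) (allSubsets ℓ)))
theorem3p3 p@(suc (suc _)) ℓ p-prime _ ℓ<p = b-zero≈1P p-prime ℓ<p , λ ν → ≋⇒≈ p (b-expansion p ν)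
theorem3p3 0 ℓ p-prime _ _ with () ← prime⇒nonTrivial p-prime
theorem3p3 1 ℓ p-prime _ _ with () ← prime⇒nonTrivial p-prime
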